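{- For every pair of integers $k,h\geq 1$ there exists a polynomial $g_{k,h}(t)\in\mathbb{Z}[t]$ such that for every matroid $\mathsf{M}$ of rank $k$ having a stressed hyperplane $H$ with $|H|=h$, if $\widetilde{\mathsf{M}}$ denotes the relaxation of $\mathsf{M}$ at $H$, then $\gamma_{\widetilde{\mathsf{M}}}(t)=\gamma_{\mathsf{M}}(t)+g_{k,h}(t)$.
   Context: A hyperplane of a matroid of rank $k$ is a flat of rank $k-1$; it is stressed if all its subsets of cardinality $k$ are circuits. If $\mathsf{M}=(E,\mathscr{B})$ has a stressed hyperplane $H$, its relaxation at $H$ is the matroid $\widetilde{\mathsf{M}}=(E,\mathscr{B}\sqcup\{S\subseteq H:|S|=k\})$. For a matroid $\mathsf{M}$ with lattice of flats $\mathscr{L}(\mathsf{M})$ and flat $F$, $\mathsf{M}^F$ is the localization (matroid on $F$ whose flats are the flats of $\mathsf{M}$ contained in $F$) and $\mathsf{M}_F$ the contraction (matroid on $E\smallsetminus F$ whose flats are $F'\smallsetminus F$ for flats $F'\supseteq F$); $\chi_{\mathsf{M}}$ is the characteristic polynomial. The Kazhdan–Lusztig polynomial $P_{\mathsf{M}}(t)$ is the unique assignment such that: if $\operatorname{rk}(\mathsf{M})=0$ then $P_{\mathsf{M}}=1$ if the ground set is empty and $0$ otherwise; if $\operatorname{rk}(\mathsf{M})>0$ then $\deg P_{\mathsf{M}}<\operatorname{rk}(\mathsf{M})/2$; and $t^{\operatorname{rk}(\mathsf{M})}P_{\mathsf{M}}(t^{ -1})=\sum_{F}\chi_{\mathsf{M}^F}(t)P_{\mathsf{M}_F}(t)$.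 The $Z$-polynomial is $Z_{\mathsf{M}}(t)=\sum_{F\in\mathscr{L}(\mathsf{M})}t^{\operatorname{rk}(F)}P_{\mathsf{M}_F}(t)$; it satisfies $Z_{\mathsf{M}}(t)=t^{\operatorname{rk}(\mathsf{M})}Z_{\mathsf{M}}(t^{ -1})$. The $\gamma$-polynomial $\gamma_{\mathsf{M}}(t)=\sum_i\gamma_i t^i$ is the unique integer polynomial with $Z_{\mathsf{M}}(t)=\sum_{i=0}^{\lfloor \operatorname{rk}(\mathsf{M})/2\rfloor}\gamma_i t^i(1+t)^{\operatorname{rk}(\mathsf{M})-2i}$. -}

module Defs where

open import Data.Bool using (Bool; true; false; _∧_; _∨_; not; if_then_else_)
open import Data.Nat using (ℕ; zero; suc; _∸_; _<ᵇ_; _≡ᵇ_; _≤ᵇ_; _⊔_; _<_)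
import Data.Nat as N
open import Data.Nat.Combinatorics using (_C_)
open import Data.Integer using (ℤ; +_; -_; _+_; _*_)
open import Data.Fin using (Fin)
open import Data.Fin.Subset using (Subset; _∩_; _∪_; _─_; ⁅_⁆; ∣_∣; ⊤; _∈_; _⊆_; _-_)
open import Data.Vec using (Vec; []; _∷_; lookup)
open import Data.List using (List; []; _∷_; map; foldr; filterᵇ; upTo; allFin; _++_; any)
open import Data.Product using (Σ; _×_; ∃)
open import Relation.Binary.PropositionalEquality using (_≡_; _≢_)

allSubsets : (n : ℕ) → List (Subset n)
allSubsets zero = [] ∷ []
allSubsets (suc n) = map (true ∷_) (allSubsets n) ++ map (false ∷_) (allSubsets n)

subᵇ : {n : ℕ} → Subset n → Subset n → Bool
subᵇ [] [] = true
subᵇ (a ∷ A) (b ∷ B) = (not a ∨ b) ∧ subᵇ A B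

nonemptyᵇ : {n : ℕ} → Subset n → Bool
nonemptyᵇ [] = false
nonemptyᵇ (a ∷ A) = a ∨ nonemptyᵇ A

-- Polynomials in ℤ[t], represented by their coefficient sequences

Poly : Set
Poly = ℕ → ℤ

IsPoly : Poly → Set
IsPoly f = Σ ℕ λ d → (i : ℕ) → d < i → f i ≡ + 0

sumℤ : List ℤ → ℤ
sumℤ = foldr _+_ (+ 0)

0P : Poly
0P _ = + 0

1P : Poly
1P zero = + 1
1P (suc _) = + 0

_+P_ : Poly → Poly → Poly
(f +P g) i = f i + g i

_*P_ : Poly → Poly → Poly
(f *P g) m = sumℤ (map (λ i → f i * g (m ∸ i)) (upTo (suc m)))

sumP : List Poly → Poly
sumP = foldr _+P_ 0P

shiftP : ℕ → Poly → Poly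
shiftP d f i = if d ≤ᵇ i then f (i ∸ d) else + 0

sign : ℕ → ℤ
sign zero = + 1
sign (suc m) = - sign m

-- A matroid "in rank-function form": ground set E ⊆ Fin n and rank
-- function r (only its values on subsets of E matter).  Used for the
-- matroid itself and its localizations / contractions.

record RMat (n : ℕ) : Set where
  field
    E : Subset n
    r : Subset n → ℕ
open RMat public

rank : {n : ℕ} → RMat n → ℕ
rank M = r M (E M)

allᵇ : {A : Set} → (A → Bool) → List A → Bool
allᵇ p = foldr (λ a b → p a ∧ b) true

isFlat : {n : ℕ} → RMat n → Subset n → Bool
isFlat {n} M F = subᵇ F (E M) ∧
  allᵇ (λ x → if lookup (E M) x ∧ not (lookup F x)
             then r M F <ᵇ r M (F ∪ ⁅ x ⁆) else true) (allFin n)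

flats : {n : ℕ} → RMat n → List (Subset n)
flats {n} M = filterᵇ (isFlat M) (allSubsets n)

localize : {n : ℕ} → RMat n → Subset n → RMat n
localize M F = record { E = F ; r = r M }

contract : {n : ℕ} → RMat n → Subset n → RMat n
contract M F = record { E = E M ─ F ; r = λ A → r M (A ∪ F) ∸ r M F }

-- characteristic polynomial (Whitney's formula):
--   χ_M(t) = Σ_{A ⊆ E} (-1)^{|A|} t^{rk E - rk A}
charPoly : {n : ℕ} → RMat n → Poly
charPoly {n} M i =
  sumℤ (map (λ A → if (rank M ∸ r M A) ≡ᵇ i then sign ∣ A ∣ else + 0)
            (filterᵇ (λ A → subᵇ A (E M)) (allSubsets n)))

-- For rk M > 0 the defining identity reads
--   t^{rk M} P_M(t^{-1}) - P_M(t) = Σ_{F flat, F ≠ ∅} χ_{M^F}(t) P_{M_F}(t)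
-- (the F = ∅ term is P_M itself when M is loopless; when M has loops all
-- terms vanish and P_M = 0), and deg P_M < rk M / 2, so P_M is minus the
-- part of the right-hand side of degree < rk M / 2.
-- The fuel decreases with |E| (contraction by a nonempty flat).
KLfuel : {n : ℕ} → ℕ → RMat n → Poly
KLfuel zero M = 0P
KLfuel (suc f) M with rank M
... | zero = if nonemptyᵇ (E M) then 0P else 1P
... | suc k = λ i → if (2 N.* i) <ᵇ suc k then - S i else + 0
  where
  S : Poly
  S = sumP (map (λ F → charPoly (localize M F) *P KLfuel f (contract M F))
                (filterᵇ nonemptyᵇ (flats M)))

KL : {n : ℕ} → RMat n → Poly
KL {n} M = KLfuel (suc n) M

Zpoly : {n : ℕ} → RMat n → Poly
Zpoly M = sumP (map (λ F → shiftP (r M F) (KL (contract M F))) (flats M))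

-- γ is the γ-polynomial of a palindromic polynomial Z of degree-parameter r:
--   γ_i = 0 for i > ⌊r/2⌋  and  Z(t) = Σ_i γ_i t^i (1+t)^{r-2i}
IsGamma : ℕ → Poly → Poly → Set
IsGamma rk Z γ =
  ((i : ℕ) → rk < 2 N.* i → γ i ≡ + 0) ×
  ((m : ℕ) → Z m ≡ sumℤ (map (λ i → γ i * (if i ≤ᵇ m then + ((rk ∸ 2 N.* i) C (m ∸ i)) else + 0))
                              (upTo (suc rk))))

Bases : ℕ → Set
Bases n = Subset n → Bool

IsBase : {n : ℕ} → Bases n → Subset n → Set
IsBase 𝓑 B = 𝓑 B ≡ true

IsMatroid : {n : ℕ} → Bases n → Set
IsMatroid {n} 𝓑 =
  (Σ (Subset n) λ B → IsBase 𝓑 B) ×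
  ((B₁ B₂ : Subset n) → IsBase 𝓑 B₁ → IsBase 𝓑 B₂ →
     (x : Fin n) → x ∈ B₁ → ¬∈ x B₂ →
     Σ (Fin n) λ y → y ∈ B₂ × ¬∈ y B₁ × IsBase 𝓑 ((B₁ - x) ∪ ⁅ y ⁆))
  where
  ¬∈ : Fin n → Subset n → Set
  ¬∈ x A = lookup A x ≡ false

rkB : {n : ℕ} → Bases n → Subset n → ℕ
rkB {n} 𝓑 A = foldr _⊔_ 0 (map (λ B → ∣ A ∩ B ∣) (filterᵇ 𝓑 (allSubsets n)))

toRMat : {n : ℕ} → Bases n → RMat n
toRMat 𝓑 = record { E = ⊤ ; r = rkB 𝓑 }

Independent : {n : ℕ} → Bases n → Subset n → Set
Independent {n} 𝓑 I = Σ (Subset n) λ B → IsBase 𝓑 B × I ⊆ B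

IsCircuit : {n : ℕ} → Bases n → Subset n → Set
IsCircuit {n} 𝓑 C =
  (Independent 𝓑 C → Data.Empty.⊥) ×
  ((D : Subset n) → D ⊆ C → D ≢ C → Independent 𝓑 D)
  where import Data.Empty

IsStressedHyperplane : {n : ℕ} → Bases n → Subset n → Set
IsStressedHyperplane {n} 𝓑 H =
  isFlat (toRMat 𝓑) H ≡ true ×
  rkB 𝓑 H ≡ rank (toRMat 𝓑) ∸ 1 ×
  ((S : Subset n) → S ⊆ H → ∣ S ∣ ≡ rank (toRMat 𝓑) → IsCircuit 𝓑 S)

relax : {n : ℕ} → Bases n → Subset n → Bases n
relax 𝓑 H S = 𝓑 S ∨ (subᵇ S H ∧ (∣ S ∣ ≡ᵇ rank (toRMat 𝓑)))

-- Relaxing H changes the rank function only on the subsets of H with at least k elements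
-- (their rank rises from k − 1 to k).  Expand the defining recursion of P and the sum for Z
-- over all subsets A of the ground set.  For A ⊈ H the term is unchanged, except that for
-- A = E the characteristic polynomial changes by a sum over subsets of H.  For A ⊆ H the
-- change depends only on k and ∣ A ∣, together with the change for the contraction by A,
-- which is again a relaxation of a stressed hyperplane, of rank k − ∣ A ∣ and size
-- ∣ H ∣ − ∣ A ∣; by induction on the rank that change is universal too.  So P and Z shift by
-- polynomials depending only on k and ∣ H ∣, and so does γ, which is recovered from Z by
-- solving a unitriangular linear system.

module Submission where

open import Defs
open import Function using (_∘_; case_of_)
open import Function.Bundles using (Equivalence)
open import Data.Bool using (Bool; true; false; _∧_; _∨_; not; if_then_else_)
open import Data.Bool.Properties using (∧-conicalˡ; ∧-conicalʳ; ∧-zeroʳ; ∨-zeroʳ; ¬-not; T-≡)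
open import Data.Nat
  using (ℕ; zero; suc; _∸_; _<ᵇ_; _≡ᵇ_; _≤ᵇ_; _⊔_; _⊓_; _≤_; _<_; _≰_; _≮_; z≤n; s≤s; _≤?_; _<?_)
  renaming (_+_ to _+ℕ_; _*_ to _*ℕ_)
open import Data.Nat.Properties
open import Data.Nat.Combinatorics using () renaming (_C_ to _choose_)
open import Data.Integer using (ℤ; +_; -_; _+_; _*_; _-_)
import Data.Integer.Properties as ℤ
open import Data.Integer.Solver using (module +-*-Solver)
open import Algebra.Properties.CommutativeSemigroup ℤ.+-commutativeSemigroup using (interchange)
open import Data.Fin using (Fin; zero; suc) renaming (_≟_ to _≟ᶠ_)
open import Data.Fin.Subset using (Subset; _∩_; _∪_; _─_; ⁅_⁆; ∣_∣; ⊤; _∈_; _∉_; _⊆_; _⊈_)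
open import Data.Fin.Subset.Properties
  using (drop-∷-⊆; out⊆; s⊆s; ⊆-refl; ⊆-trans; ⊆-antisym; ⊆⊤; ∈⊤; ⊥⊆; ∣⊥∣≡0; ∣p∣≤n; ∣⁅x⁆∣≡1;
         x∈⁅x⁆; x∈⁅y⁆⇒x≡y; p⊆q⇒∣p∣≤∣q∣; x∈p∪q⁻; p⊆p∪q; q⊆p∪q; ∪-assoc; ∪-comm; p─q⊆p;
         x∈p∧x∉q⇒x∈p─q; x∈p∧x≢y⇒x∈p-y; p∩q⊆p; p∩q⊆q; x∈p∩q⁺; x∈p∩q⁻; ∣p∩q∣≤∣p∣; ∣p∩q∣≤∣q∣;
         ∩-identityˡ; _∈?_; _⊆?_)
open import Data.Vec using ([]; _∷_; lookup; here; there)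
open import Data.Vec.Properties using ([]=⇒lookup; lookup⇒[]=)
open import Data.List using (List; []; _∷_; map; foldr; filterᵇ; upTo; allFin; _++_)
open import Data.List.Properties using (map-++; map-∘; upTo-∷ʳ)
open import Data.List.Membership.Propositional using () renaming (_∈_ to _∈ˡ_)
open import Data.List.Membership.Propositional.Properties
  using (∈-allFin; ∈-upTo⁻; ∈-++⁺ˡ; ∈-++⁺ʳ; ∈-map⁺)
open import Data.List.Relation.Unary.Any using () renaming (here to hereˡ; there to thereˡ)
open import Data.Product using (Σ; ∃-syntax; _×_; _,_; proj₁; proj₂)
open import Data.Sum using (_⊎_; inj₁; inj₂; [_,_])
open import Relation.Binary.PropositionalEquality
  using (_≡_; _≢_; _≗_; refl; sym; trans; cong; cong₂; subst; subst₂; module ≡-Reasoning)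
open import Relation.Nullary using (¬_; Dec; yes; no; contradiction)

private variable
  n m k : ℕ
  x : Fin n
  A B C D : Subset n
  M N : RMat n
  P Q R : Poly
  X : Set

≤⇒≤ᵇ≡true : m ≤ k → (m ≤ᵇ k) ≡ true
≤⇒≤ᵇ≡true = Equivalence.to T-≡ ∘ ≤⇒≤ᵇ

≤ᵇ≡true⇒≤ : (m ≤ᵇ k) ≡ true → m ≤ k
≤ᵇ≡true⇒≤ {m} {k} = ≤ᵇ⇒≤ m k ∘ Equivalence.from T-≡

≰⇒≤ᵇ≡false : m ≰ k → (m ≤ᵇ k) ≡ false
≰⇒≤ᵇ≡false m≰k = ¬-not (m≰k ∘ ≤ᵇ≡true⇒≤)

<⇒<ᵇ≡true : m < k → (m <ᵇ k) ≡ true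
<⇒<ᵇ≡true = Equivalence.to T-≡ ∘ <⇒<ᵇ

<ᵇ≡true⇒< : (m <ᵇ k) ≡ true → m < k
<ᵇ≡true⇒< {m} {k} = <ᵇ⇒< m k ∘ Equivalence.from T-≡

≮⇒<ᵇ≡false : m ≮ k → (m <ᵇ k) ≡ false
≮⇒<ᵇ≡false m≮k = ¬-not (m≮k ∘ <ᵇ≡true⇒<)

≡⇒≡ᵇ≡true : m ≡ k → (m ≡ᵇ k) ≡ true
≡⇒≡ᵇ≡true {m} {k} = Equivalence.to T-≡ ∘ ≡⇒≡ᵇ m k

≡ᵇ≡true⇒≡ : (m ≡ᵇ k) ≡ true → m ≡ k
≡ᵇ≡true⇒≡ {m} {k} = ≡ᵇ⇒≡ m k ∘ Equivalence.from T-≡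

≢⇒≡ᵇ≡false : m ≢ k → (m ≡ᵇ k) ≡ false
≢⇒≡ᵇ≡false m≢k = ¬-not (m≢k ∘ ≡ᵇ≡true⇒≡)

if-true : {X : Set} {b : Bool} {x y : X} → b ≡ true → (if b then x else y) ≡ x
if-true refl = refl

if-false : {X : Set} {b : Bool} {x y : X} → b ≡ false → (if b then x else y) ≡ y
if-false refl = refl

∈⇒lookup≡true : x ∈ A → lookup A x ≡ true
∈⇒lookup≡true = []=⇒lookup

lookup≡true⇒∈ : lookup A x ≡ true → x ∈ A
lookup≡true⇒∈ {A = A} {x} = lookup⇒[]= x A

∉⇒lookup≡false : x ∉ A → lookup A x ≡ false
∉⇒lookup≡false x∉A = ¬-not (x∉A ∘ lookup≡true⇒∈)

lookup≡false⇒∉ : lookup A x ≡ false → x ∉ A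
lookup≡false⇒∉ eq x∈A with () ← trans (sym eq) (∈⇒lookup≡true x∈A)

subᵇ⇒⊆ : subᵇ A B ≡ true → A ⊆ B
subᵇ⇒⊆ {A = true ∷ A} {true ∷ B} s here = here
subᵇ⇒⊆ {A = true ∷ A} {false ∷ B} () here
subᵇ⇒⊆ {A = a ∷ A} {b ∷ B} s (there x∈A) = there (subᵇ⇒⊆ (∧-conicalʳ (not a ∨ b) _ s) x∈A)

⊆⇒subᵇ : A ⊆ B → subᵇ A B ≡ true
⊆⇒subᵇ {A = []} {[]} _ = refl
⊆⇒subᵇ {A = false ∷ A} {b ∷ B} A⊆B = ⊆⇒subᵇ (drop-∷-⊆ A⊆B)
⊆⇒subᵇ {A = true ∷ A} {true ∷ B} A⊆B = ⊆⇒subᵇ (drop-∷-⊆ A⊆B)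
⊆⇒subᵇ {A = true ∷ A} {false ∷ B} A⊆B = contradiction (A⊆B here) λ ()

⊈⇒subᵇ : A ⊈ B → subᵇ A B ≡ false
⊈⇒subᵇ A⊈B = ¬-not (A⊈B ∘ subᵇ⇒⊆)

∃-there : ∀ {a b} → ∃[ x ] x ∈ A × x ∉ B → ∃[ x ] x ∈ a ∷ A × x ∉ b ∷ B
∃-there (x , x∈A , x∉B) = suc x , there x∈A , λ { (there x∈B) → x∉B x∈B }

subᵇ≡false⇒∃ : subᵇ A B ≡ false → ∃[ x ] x ∈ A × x ∉ B
subᵇ≡false⇒∃ {A = []} {[]} ()
subᵇ≡false⇒∃ {A = true ∷ A} {false ∷ B} _ = zero , here , λ ()
subᵇ≡false⇒∃ {A = false ∷ A} {b ∷ B} s = ∃-there (subᵇ≡false⇒∃ s)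
subᵇ≡false⇒∃ {A = true ∷ A} {true ∷ B} s = ∃-there (subᵇ≡false⇒∃ s)

⊈⇒∃ : A ⊈ B → ∃[ x ] x ∈ A × x ∉ B
⊈⇒∃ = subᵇ≡false⇒∃ ∘ ⊈⇒subᵇ

⁅x⁆⊆ : x ∈ A → ⁅ x ⁆ ⊆ A
⁅x⁆⊆ {x = x} {A} x∈A y∈⁅x⁆ = subst (_∈ A) (sym (x∈⁅y⁆⇒x≡y x y∈⁅x⁆)) x∈A

∪-⊆ : A ⊆ C → B ⊆ C → A ∪ B ⊆ C
∪-⊆ {A = A} {B = B} A⊆C B⊆C = [ A⊆C , B⊆C ] ∘ x∈p∪q⁻ A B

∪⁅x⁆-⊆ : A ⊆ C → x ∈ C → A ∪ ⁅ x ⁆ ⊆ C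
∪⁅x⁆-⊆ A⊆C x∈C = ∪-⊆ A⊆C (⁅x⁆⊆ x∈C)

x∈p─q⇒x∉q : x ∈ A ─ B → x ∉ B
x∈p─q⇒x∉q {A = a ∷ A} {true ∷ B} (there x∈A─B) (there x∈B) = x∈p─q⇒x∉q x∈A─B x∈B
x∈p─q⇒x∉q {A = a ∷ A} {false ∷ B} (there x∈A─B) (there x∈B) = x∈p─q⇒x∉q x∈A─B x∈B

empty-∪ : (∀ {x} → x ∉ A) → A ∪ B ≡ B
empty-∪ {A = A} {B = B} empty = ⊆-antisym (∪-⊆ (λ x∈A → contradiction x∈A empty) ⊆-refl) (q⊆p∪q A B)

⊆-exchange : ∀ {y z} → A ⊆ B → y ∉ A → A ⊆ (B ─ ⁅ y ⁆) ∪ ⁅ z ⁆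
⊆-exchange {y = y} {z} A⊆B y∉A {x} x∈A =
  p⊆p∪q ⁅ z ⁆ (x∈p∧x≢y⇒x∈p-y (A⊆B x∈A) λ x≡y → y∉A (subst (_∈ _) x≡y x∈A))

∈-exchange : ∀ {y z} → z ∈ (B ─ ⁅ y ⁆) ∪ ⁅ z ⁆
∈-exchange {B = B} {y} {z} = q⊆p∪q (B ─ ⁅ y ⁆) ⁅ z ⁆ (x∈⁅x⁆ z)

─∪≡ : A ⊆ D → (D ─ A) ∪ A ≡ D
─∪≡ {A = A} {D = D} A⊆D = ⊆-antisym (∪-⊆ (p─q⊆p D A) A⊆D) D⊆
  where
  D⊆ : D ⊆ (D ─ A) ∪ A
  D⊆ {x} x∈D with x ∈? A
  ... | yes x∈A = q⊆p∪q (D ─ A) A x∈A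
  ... | no x∉A = p⊆p∪q A (x∈p∧x∉q⇒x∈p─q x∈D x∉A)

⊆∧∣≥∣⇒≡ : A ⊆ B → ∣ B ∣ ≤ ∣ A ∣ → A ≡ B
⊆∧∣≥∣⇒≡ {A = []} {[]} _ _ = refl
⊆∧∣≥∣⇒≡ {A = true ∷ A} {true ∷ B} A⊆B (s≤s le) = cong (true ∷_) (⊆∧∣≥∣⇒≡ (drop-∷-⊆ A⊆B) le)
⊆∧∣≥∣⇒≡ {A = false ∷ A} {false ∷ B} A⊆B le = cong (false ∷_) (⊆∧∣≥∣⇒≡ (drop-∷-⊆ A⊆B) le)
⊆∧∣≥∣⇒≡ {A = false ∷ A} {true ∷ B} A⊆B le =
  contradiction le (<⇒≱ (s≤s (p⊆q⇒∣p∣≤∣q∣ (drop-∷-⊆ A⊆B))))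
⊆∧∣≥∣⇒≡ {A = true ∷ A} {false ∷ B} A⊆B _ = contradiction (A⊆B here) λ ()

∣<∣⇒∃ : ∣ A ∣ < ∣ B ∣ → ∃[ x ] x ∈ B × x ∉ A
∣<∣⇒∃ lt = ⊈⇒∃ (λ B⊆A → <⇒≱ lt (p⊆q⇒∣p∣≤∣q∣ B⊆A))

∈⇒∣∣>0 : x ∈ A → 0 < ∣ A ∣
∈⇒∣∣>0 {x = x} x∈A = ≤-trans (≤-reflexive (sym (∣⁅x⁆∣≡1 x))) (p⊆q⇒∣p∣≤∣q∣ (⁅x⁆⊆ x∈A))

∣∣>0⇒∃ : 0 < ∣ A ∣ → ∃[ x ] x ∈ A
∣∣>0⇒∃ {A = true ∷ A} _ = zero , here
∣∣>0⇒∃ {A = false ∷ A} pos with ∣∣>0⇒∃ pos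
... | x , x∈A = suc x , there x∈A

∣∣≡0⇒∉ : ∣ A ∣ ≡ 0 → x ∉ A
∣∣≡0⇒∉ eq x∈A = <⇒≢ (∈⇒∣∣>0 x∈A) (sym eq)

∣∪∣-disjoint : (∀ {x} → x ∈ A → x ∉ B) → ∣ A ∪ B ∣ ≡ ∣ A ∣ +ℕ ∣ B ∣
∣∪∣-disjoint {A = []} {[]} _ = refl
∣∪∣-disjoint {A = true ∷ A} {true ∷ B} disj = contradiction here (disj here)
∣∪∣-disjoint {A = true ∷ A} {false ∷ B} disj =
  cong suc (∣∪∣-disjoint λ x∈A x∈B → disj (there x∈A) (there x∈B))
∣∪∣-disjoint {A = false ∷ A} {true ∷ B} disj =
  trans (cong suc (∣∪∣-disjoint λ x∈A x∈B → disj (there x∈A) (there x∈B))) (sym (+-suc _ _))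
∣∪∣-disjoint {A = false ∷ A} {false ∷ B} disj =
  ∣∪∣-disjoint λ x∈A x∈B → disj (there x∈A) (there x∈B)

∣∪⁅x⁆∣≡ : x ∉ A → ∣ A ∪ ⁅ x ⁆ ∣ ≡ suc ∣ A ∣
∣∪⁅x⁆∣≡ {x = x} {A} x∉A = begin
  ∣ A ∪ ⁅ x ⁆ ∣      ≡⟨ ∣∪∣-disjoint (λ y∈A y∈⁅x⁆ → x∉A (subst (_∈ A) (x∈⁅y⁆⇒x≡y x y∈⁅x⁆) y∈A)) ⟩
  ∣ A ∣ +ℕ ∣ ⁅ x ⁆ ∣ ≡⟨ cong (∣ A ∣ +ℕ_) (∣⁅x⁆∣≡1 x) ⟩
  ∣ A ∣ +ℕ 1         ≡⟨ +-comm ∣ A ∣ 1 ⟩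
  suc ∣ A ∣          ∎
  where open ≡-Reasoning

∣∪⁅x⁆∣≤ : (A : Subset n) (x : Fin n) → ∣ A ∪ ⁅ x ⁆ ∣ ≤ suc ∣ A ∣
∣∪⁅x⁆∣≤ A x with x ∈? A
... | yes x∈A = m≤n⇒m≤1+n (p⊆q⇒∣p∣≤∣q∣ (∪⁅x⁆-⊆ ⊆-refl x∈A))
... | no x∉A = ≤-reflexive (∣∪⁅x⁆∣≡ x∉A)

∣─∣+∣∣≡ : A ⊆ D → ∣ D ─ A ∣ +ℕ ∣ A ∣ ≡ ∣ D ∣
∣─∣+∣∣≡ {A = A} {D = D} A⊆D =
  trans (sym (∣∪∣-disjoint (x∈p─q⇒x∉q {A = D}))) (cong ∣_∣ (─∪≡ A⊆D))

∩-⊆-mono : A ⊆ B → A ∩ C ⊆ B ∩ C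
∩-⊆-mono {A = A} {C = C} A⊆B x∈A∩C with x∈p∩q⁻ A C x∈A∩C
... | x∈A , x∈C = x∈p∩q⁺ (A⊆B x∈A , x∈C)

⊆⇒∩≡ : A ⊆ B → A ∩ B ≡ A
⊆⇒∩≡ {A = A} {B = B} A⊆B = ⊆-antisym (p∩q⊆p A B) (λ x∈A → x∈p∩q⁺ (x∈A , A⊆B x∈A))

∣∩∣≡∣∣⇒⊆ : ∣ A ∩ B ∣ ≡ ∣ A ∣ → A ⊆ B
∣∩∣≡∣∣⇒⊆ {A = A} {B = B} eq x∈A =
  proj₂ (x∈p∩q⁻ A B (subst (_ ∈_) (sym (⊆∧∣≥∣⇒≡ (p∩q⊆p A B) (≤-reflexive (sym eq)))) x∈A))

intermediateSubset : B ⊆ C → ∣ B ∣ ≤ m → m ≤ ∣ C ∣ → ∃[ S ] B ⊆ S × S ⊆ C × ∣ S ∣ ≡ m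
intermediateSubset {B = []} {[]} _ _ le = [] , (λ ()) , (λ ()) , sym (n≤0⇒n≡0 le)
intermediateSubset {B = true ∷ B} {false ∷ C} B⊆C _ _ = contradiction (B⊆C here) λ ()
intermediateSubset {B = true ∷ B} {true ∷ C} {suc m} B⊆C (s≤s lo) (s≤s hi)
  with intermediateSubset (drop-∷-⊆ B⊆C) lo hi
... | S , B⊆S , S⊆C , ∣S∣ = true ∷ S , s⊆s B⊆S , s⊆s S⊆C , cong suc ∣S∣
intermediateSubset {B = false ∷ B} {false ∷ C} B⊆C lo hi
  with intermediateSubset (drop-∷-⊆ B⊆C) lo hi
... | S , B⊆S , S⊆C , ∣S∣ = false ∷ S , s⊆s B⊆S , s⊆s S⊆C , ∣S∣
intermediateSubset {B = false ∷ B} {true ∷ C} {m} B⊆C lo hi with m ≤? ∣ C ∣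
... | yes hi′ with intermediateSubset (drop-∷-⊆ B⊆C) lo hi′
...   | S , B⊆S , S⊆C , ∣S∣ = false ∷ S , s⊆s B⊆S , out⊆ S⊆C , ∣S∣
intermediateSubset {B = false ∷ B} {true ∷ C} {m} B⊆C lo hi | no m≰∣C∣ =
  true ∷ C , out⊆ (drop-∷-⊆ B⊆C) , ⊆-refl , ≤-antisym (≰⇒> m≰∣C∣) hi

subsetOfSize : (C : Subset n) → m ≤ ∣ C ∣ → ∃[ S ] S ⊆ C × ∣ S ∣ ≡ m
subsetOfSize {n = n} C hi with intermediateSubset ⊥⊆ (≤-trans (≤-reflexive (∣⊥∣≡0 n)) z≤n) hi
... | S , _ , S⊆C , ∣S∣ = S , S⊆C , ∣S∣

nonemptyᵇ-∈ : x ∈ A → nonemptyᵇ A ≡ true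
nonemptyᵇ-∈ {A = true ∷ A} _ = refl
nonemptyᵇ-∈ {A = false ∷ A} (there x∈A) = nonemptyᵇ-∈ x∈A

nonemptyᵇ-empty : (∀ {x} → x ∉ A) → nonemptyᵇ A ≡ false
nonemptyᵇ-empty {A = []} _ = refl
nonemptyᵇ-empty {A = true ∷ A} empty = contradiction here empty
nonemptyᵇ-empty {A = false ∷ A} empty = nonemptyᵇ-empty (empty ∘ there)

sumℤ-++ : (xs ys : List ℤ) → sumℤ (xs ++ ys) ≡ sumℤ xs + sumℤ ys
sumℤ-++ [] ys = sym (ℤ.+-identityˡ _)
sumℤ-++ (x ∷ xs) ys = trans (cong (_+_ x) (sumℤ-++ xs ys)) (sym (ℤ.+-assoc x _ _))

sumℤ-map-cong : {f g : X → ℤ} (L : List X) → (∀ {a} → a ∈ˡ L → f a ≡ g a) →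
  sumℤ (map f L) ≡ sumℤ (map g L)
sumℤ-map-cong [] f≗g = refl
sumℤ-map-cong (a ∷ L) f≗g = cong₂ _+_ (f≗g (hereˡ refl)) (sumℤ-map-cong L (f≗g ∘ thereˡ))

sumℤ-map-+ : (f g : X → ℤ) (L : List X) →
  sumℤ (map (λ a → f a + g a) L) ≡ sumℤ (map f L) + sumℤ (map g L)
sumℤ-map-+ f g [] = refl
sumℤ-map-+ f g (a ∷ L) =
  trans (cong (_+_ (f a + g a)) (sumℤ-map-+ f g L)) (interchange (f a) (g a) _ _)

sumℤ-map-0 : (L : List X) → sumℤ (map (λ _ → + 0) L) ≡ + 0
sumℤ-map-0 [] = refl
sumℤ-map-0 (_ ∷ L) = trans (ℤ.+-identityˡ _) (sumℤ-map-0 L)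

sumℤ-map-filterᵇ : (p : X → Bool) (f : X → ℤ) (L : List X) →
  sumℤ (map f (filterᵇ p L)) ≡ sumℤ (map (λ a → if p a then f a else + 0) L)
sumℤ-map-filterᵇ p f [] = refl
sumℤ-map-filterᵇ p f (a ∷ L) with p a
... | true = cong (_+_ (f a)) (sumℤ-map-filterᵇ p f L)
... | false = trans (sumℤ-map-filterᵇ p f L) (sym (ℤ.+-identityˡ _))

sumP-map-coeff : (P : X → Poly) (L : List X) (i : ℕ) →
  sumP (map P L) i ≡ sumℤ (map (λ a → P a i) L)
sumP-map-coeff P [] i = refl
sumP-map-coeff P (a ∷ L) i = cong (_+_ (P a i)) (sumP-map-coeff P L i)

sumℤ-upTo-suc : (F : ℕ → ℤ) (k : ℕ) →
  sumℤ (map F (upTo (suc k))) ≡ sumℤ (map F (upTo k)) + F k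
sumℤ-upTo-suc F k = begin
  sumℤ (map F (upTo (suc k)))            ≡⟨ cong (sumℤ ∘ map F) (sym (upTo-∷ʳ k)) ⟩
  sumℤ (map F (upTo k ++ k ∷ []))        ≡⟨ cong sumℤ (map-++ F (upTo k) (k ∷ [])) ⟩
  sumℤ (map F (upTo k) ++ F k ∷ [])      ≡⟨ sumℤ-++ (map F (upTo k)) (F k ∷ []) ⟩
  sumℤ (map F (upTo k)) + (F k + + 0)    ≡⟨ cong (_+_ (sumℤ (map F (upTo k)))) (ℤ.+-identityʳ (F k)) ⟩
  sumℤ (map F (upTo k)) + F k            ∎
  where open ≡-Reasoning

Σₛ : (Subset n → ℤ) → ℤ
Σₛ f = sumℤ (map f (allSubsets _))

Σₛ-cong : {f g : Subset n → ℤ} → (∀ A → f A ≡ g A) → Σₛ f ≡ Σₛ g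
Σₛ-cong f≗g = sumℤ-map-cong (allSubsets _) λ {A} _ → f≗g A

Σₛ-+ : (f g : Subset n → ℤ) → Σₛ (λ A → f A + g A) ≡ Σₛ f + Σₛ g
Σₛ-+ f g = sumℤ-map-+ f g (allSubsets _)

Σₛ-filterᵇ : (p : Subset n → Bool) (f : Subset n → ℤ) →
  sumℤ (map f (filterᵇ p (allSubsets n))) ≡ Σₛ (λ A → if p A then f A else + 0)
Σₛ-filterᵇ p f = sumℤ-map-filterᵇ p f (allSubsets _)

-- Σⱼ (h choose j) c j, computed by Pascal's rule
binomialSum : ℕ → (ℕ → ℤ) → ℤ
binomialSum zero c = c 0
binomialSum (suc h) c = binomialSum h (c ∘ suc) + binomialSum h c

Σₛ-⊆-by-size : (H : Subset n) (c : ℕ → ℤ) →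
  Σₛ (λ A → if subᵇ A H then c ∣ A ∣ else + 0) ≡ binomialSum ∣ H ∣ c
Σₛ-⊆-by-size [] c = ℤ.+-identityʳ (c 0)
Σₛ-⊆-by-size {suc n} (b ∷ H) c = begin
  sumℤ (map F (map (true ∷_) S ++ map (false ∷_) S))
    ≡⟨ cong sumℤ (map-++ F (map (true ∷_) S) (map (false ∷_) S)) ⟩
  sumℤ (map F (map (true ∷_) S) ++ map F (map (false ∷_) S))
    ≡⟨ sumℤ-++ (map F (map (true ∷_) S)) _ ⟩
  sumℤ (map F (map (true ∷_) S)) + sumℤ (map F (map (false ∷_) S))
    ≡⟨ cong₂ (λ xs ys → sumℤ xs + sumℤ ys) (sym (map-∘ S)) (sym (map-∘ S)) ⟩
  Σₛ (F ∘ (true ∷_)) + Σₛ (F ∘ (false ∷_))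
    ≡⟨ split b ⟩
  binomialSum ∣ b ∷ H ∣ c ∎
  where
  open ≡-Reasoning
  S : List (Subset n)
  S = allSubsets n
  F : Subset (suc n) → ℤ
  F A = if subᵇ A (b ∷ H) then c ∣ A ∣ else + 0
  split : (b : Bool) →
    Σₛ (λ A → if subᵇ (true ∷ A) (b ∷ H) then c ∣ true ∷ A ∣ else + 0) +
    Σₛ (λ A → if subᵇ (false ∷ A) (b ∷ H) then c ∣ false ∷ A ∣ else + 0)
    ≡ binomialSum ∣ b ∷ H ∣ c
  split true = cong₂ _+_ (Σₛ-⊆-by-size H (c ∘ suc)) (Σₛ-⊆-by-size H c)
  split false = trans (cong₂ _+_ (sumℤ-map-0 S) (Σₛ-⊆-by-size H c)) (ℤ.+-identityˡ _)

binomialSum-cong : (h : ℕ) {c d : ℕ → ℤ} → (∀ j → j ≤ h → c j ≡ d j) →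
  binomialSum h c ≡ binomialSum h d
binomialSum-cong zero c≗d = c≗d 0 z≤n
binomialSum-cong (suc h) c≗d =
  cong₂ _+_ (binomialSum-cong h λ j le → c≗d (suc j) (s≤s le))
            (binomialSum-cong h λ j le → c≗d j (≤-trans le (n≤1+n h)))

binomialSum-+ : (h : ℕ) (c d : ℕ → ℤ) →
  binomialSum h (λ j → c j + d j) ≡ binomialSum h c + binomialSum h d
binomialSum-+ zero c d = refl
binomialSum-+ (suc h) c d =
  trans (cong₂ _+_ (binomialSum-+ h (c ∘ suc) (d ∘ suc)) (binomialSum-+ h c d))
        (interchange (binomialSum h (c ∘ suc)) _ _ _)

binomialSum-neg : (h : ℕ) (c : ℕ → ℤ) → binomialSum h (λ j → - c j) ≡ - binomialSum h c
binomialSum-neg zero c = refl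
binomialSum-neg (suc h) c =
  trans (cong₂ _+_ (binomialSum-neg h (c ∘ suc)) (binomialSum-neg h c))
        (sym (ℤ.neg-distrib-+ (binomialSum h (c ∘ suc)) _))

binomialSum-0 : (h : ℕ) → binomialSum h (λ _ → + 0) ≡ + 0
binomialSum-0 zero = refl
binomialSum-0 (suc h) = cong₂ _+_ (binomialSum-0 h) (binomialSum-0 h)

binomialSum-top : (h : ℕ) (v : ℤ) → binomialSum h (λ j → if j ≡ᵇ h then v else + 0) ≡ v
binomialSum-top zero v = refl
binomialSum-top (suc h) v = begin
  binomialSum h (λ j → if j ≡ᵇ h then v else + 0) + binomialSum h below
    ≡⟨ cong₂ _+_ (binomialSum-top h v) (binomialSum-cong h below≡0) ⟩
  v + binomialSum h (λ _ → + 0)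
    ≡⟨ cong (_+_ v) (binomialSum-0 h) ⟩
  v + + 0
    ≡⟨ ℤ.+-identityʳ v ⟩
  v ∎
  where
  open ≡-Reasoning
  below : ℕ → ℤ
  below j = if j ≡ᵇ suc h then v else + 0
  below≡0 : ∀ j → j ≤ h → below j ≡ + 0
  below≡0 j le = cong (if_then v else + 0) (≢⇒≡ᵇ≡false λ j≡1+h → <-irrefl refl (subst (_≤ h) j≡1+h le))

binomialSum-bottom : (h : ℕ) (v : ℤ) → binomialSum h (λ j → if j ≡ᵇ 0 then v else + 0) ≡ v
binomialSum-bottom zero v = refl
binomialSum-bottom (suc h) v =
  trans (cong₂ _+_ (binomialSum-0 h) (binomialSum-bottom h v)) (ℤ.+-identityˡ v)

binomialSum-sign : (h : ℕ) → binomialSum h sign ≡ (if h ≡ᵇ 0 then + 1 else + 0)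
binomialSum-sign zero = refl
binomialSum-sign (suc h) =
  trans (cong (_+ binomialSum h sign) (binomialSum-neg h sign)) (ℤ.+-inverseˡ (binomialSum h sign))

*P-congˡ : (R : Poly) → P ≗ Q → (P *P R) ≗ (Q *P R)
*P-congˡ R P≗Q m = sumℤ-map-cong (upTo (suc m)) λ {i} _ → cong (_* R (m ∸ i)) (P≗Q i)

*P-congʳ : (P : Poly) → Q ≗ R → (P *P Q) ≗ (P *P R)
*P-congʳ P Q≗R m = sumℤ-map-cong (upTo (suc m)) λ {i} _ → cong (P i *_) (Q≗R (m ∸ i))

*P-distribˡ-+P : (P Q R : Poly) → (P *P (Q +P R)) ≗ ((P *P Q) +P (P *P R))
*P-distribˡ-+P P Q R m =
  trans (sumℤ-map-cong (upTo (suc m)) λ {i} _ → ℤ.*-distribˡ-+ (P i) (Q (m ∸ i)) (R (m ∸ i)))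
        (sumℤ-map-+ (λ i → P i * Q (m ∸ i)) (λ i → P i * R (m ∸ i)) (upTo (suc m)))

*P-identityʳ : (P : Poly) → (P *P 1P) ≗ P
*P-identityʳ P m = begin
  sumℤ (map (λ i → P i * 1P (m ∸ i)) (upTo (suc m)))
    ≡⟨ sumℤ-upTo-suc (λ i → P i * 1P (m ∸ i)) m ⟩
  sumℤ (map (λ i → P i * 1P (m ∸ i)) (upTo m)) + P m * 1P (m ∸ m)
    ≡⟨ cong₂ _+_ (sumℤ-map-cong (upTo m) (below ∘ ∈-upTo⁻)) (cong (λ j → P m * 1P j) (n∸n≡0 m)) ⟩
  sumℤ (map (λ _ → + 0) (upTo m)) + P m * + 1
    ≡⟨ cong₂ _+_ (sumℤ-map-0 (upTo m)) (ℤ.*-identityʳ (P m)) ⟩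
  + 0 + P m
    ≡⟨ ℤ.+-identityˡ (P m) ⟩
  P m ∎
  where
  open ≡-Reasoning
  below : ∀ {i} → i < m → P i * 1P (m ∸ i) ≡ + 0
  below {i} i<m with m ∸ i in eq
  ... | zero = contradiction (m∸n≡0⇒m≤n eq) (<⇒≱ i<m)
  ... | suc _ = ℤ.*-zeroʳ (P i)

shiftP-cong : (d : ℕ) → P ≗ Q → shiftP d P ≗ shiftP d Q
shiftP-cong d P≗Q m with d ≤ᵇ m
... | true = P≗Q (m ∸ d)
... | false = refl

shiftP-+P : (d : ℕ) (P Q : Poly) → shiftP d (P +P Q) ≗ (shiftP d P +P shiftP d Q)
shiftP-+P d P Q m with d ≤ᵇ m
... | true = refl
... | false = refl

allᵇ-⁺ : {p : X → Bool} (L : List X) → (∀ a → p a ≡ true) → allᵇ p L ≡ true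
allᵇ-⁺ [] _ = refl
allᵇ-⁺ (a ∷ L) all rewrite all a = allᵇ-⁺ L all

allᵇ-⁻ : {p : X → Bool} {L : List X} {a : X} → allᵇ p L ≡ true → a ∈ˡ L → p a ≡ true
allᵇ-⁻ {p = p} {b ∷ L} all (hereˡ refl) = ∧-conicalˡ (p b) _ all
allᵇ-⁻ {p = p} {b ∷ L} all (thereˡ a∈L) = allᵇ-⁻ (∧-conicalʳ (p b) _ all) a∈L

record IsFlat (M : RMat n) (F : Subset n) : Set where
  constructor mkIsFlat
  field
    ⊆E : F ⊆ E M
    closed : ∀ {x} → x ∈ E M → x ∉ F → r M F < r M (F ∪ ⁅ x ⁆)

closedᵇ : RMat n → Subset n → Fin n → Bool
closedᵇ M F x = if lookup (E M) x ∧ not (lookup F x) then r M F <ᵇ r M (F ∪ ⁅ x ⁆) else true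

isFlat⇒IsFlat : ∀ {F} → isFlat M F ≡ true → IsFlat M F
isFlat⇒IsFlat {M = M} {F} eq = mkIsFlat (subᵇ⇒⊆ (∧-conicalˡ _ _ eq)) λ {x} x∈E x∉F →
  <ᵇ≡true⇒< (trans (cong₂ (λ a b → if a ∧ not b then r M F <ᵇ r M (F ∪ ⁅ x ⁆) else true)
                          (sym (∈⇒lookup≡true x∈E)) (sym (∉⇒lookup≡false x∉F)))
                   (allᵇ-⁻ {p = closedᵇ M F} (∧-conicalʳ (subᵇ F (E M)) _ eq) (∈-allFin x)))

IsFlat⇒isFlat : ∀ {F} → IsFlat M F → isFlat M F ≡ true
IsFlat⇒isFlat {M = M} {F} (mkIsFlat F⊆E closed) rewrite ⊆⇒subᵇ F⊆E = allᵇ-⁺ (allFin _) closedAt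
  where
  closedAt : ∀ x → closedᵇ M F x ≡ true
  closedAt x with lookup (E M) x in x∈E | lookup F x in x∉F
  ... | true | false = <⇒<ᵇ≡true (closed (lookup≡true⇒∈ x∈E) (lookup≡false⇒∉ x∉F))
  ... | true | true = refl
  ... | false | _ = refl

IsFlat? : (M : RMat n) (F : Subset n) → Dec (IsFlat M F)
IsFlat? M F with isFlat M F in flat
... | true = yes (isFlat⇒IsFlat flat)
... | false = no λ isFlat′ → case trans (sym flat) (IsFlat⇒isFlat isFlat′) of λ ()

¬IsFlat⇒isFlat≡false : ∀ {F} → ¬ IsFlat M F → isFlat M F ≡ false
¬IsFlat⇒isFlat≡false {M = M} ¬flat = ¬-not (¬flat ∘ isFlat⇒IsFlat {M = M})

isFlat-nonclosed : (M : RMat n) (F : Subset n) → ∀ {x} → x ∈ E M → x ∉ F → r M (F ∪ ⁅ x ⁆) ≤ r M F →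
  isFlat M F ≡ false
isFlat-nonclosed M F x∈E x∉F le = ¬-not λ eq → <⇒≱ (IsFlat.closed (isFlat⇒IsFlat {M = M} eq) x∈E x∉F) le

isFlat-⊈ : (M : RMat n) (F : Subset n) → F ⊈ E M → isFlat M F ≡ false
isFlat-⊈ M F F⊈E = ¬-not (F⊈E ∘ IsFlat.⊆E ∘ isFlat⇒IsFlat {M = M})

IsFlat-E : (M : RMat n) → IsFlat M (E M)
IsFlat-E M = mkIsFlat ⊆-refl λ x∈E x∉E → contradiction x∈E x∉E

isFlat-reflects : ∀ {F} → (IsFlat M F → IsFlat N F) → (IsFlat N F → IsFlat M F) → isFlat M F ≡ isFlat N F
isFlat-reflects {M = M} {N = N} {F = F} to from with isFlat M F in flM | isFlat N F in flN
... | true | true = refl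
... | false | false = refl
... | true | false with () ← trans (sym flN) (IsFlat⇒isFlat (to (isFlat⇒IsFlat flM)))
... | false | true with () ← trans (sym flM) (IsFlat⇒isFlat (from (isFlat⇒IsFlat flN)))

AgreeAround : RMat n → RMat n → Subset n → Set
AgreeAround M N F =
  F ⊆ E M → r M F ≡ r N F × (∀ {x} → x ∈ E M → x ∉ F → r M (F ∪ ⁅ x ⁆) ≡ r N (F ∪ ⁅ x ⁆))

isFlat-cong : ∀ {F} (M N : RMat n) → E M ≡ E N → AgreeAround M N F → isFlat M F ≡ isFlat N F
isFlat-cong {F = F} M N E≡ agree = isFlat-reflects to from
  where
  to : IsFlat M F → IsFlat N F
  to (mkIsFlat F⊆E closed) = mkIsFlat (subst (F ⊆_) E≡ F⊆E) λ x∈E x∉F →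
    let x∈E′ = subst (_ ∈_) (sym E≡) x∈E in
    subst₂ _<_ (proj₁ (agree F⊆E)) (proj₂ (agree F⊆E) x∈E′ x∉F) (closed x∈E′ x∉F)
  from : IsFlat N F → IsFlat M F
  from (mkIsFlat F⊆E closed) = mkIsFlat F⊆E′ λ x∈E x∉F →
    subst₂ _<_ (sym (proj₁ (agree F⊆E′))) (sym (proj₂ (agree F⊆E′) x∈E x∉F))
          (closed (subst (_ ∈_) E≡ x∈E) x∉F)
    where
    F⊆E′ : F ⊆ E M
    F⊆E′ = subst (F ⊆_) (sym E≡) F⊆E

-- The Kazhdan–Lusztig recursion

charTerm : RMat n → ℕ → Subset n → ℤ
charTerm M i B = if subᵇ B (E M) then (if (rank M ∸ r M B) ≡ᵇ i then sign ∣ B ∣ else + 0) else + 0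

charPoly-expand : (M : RMat n) (i : ℕ) → charPoly M i ≡ Σₛ (charTerm M i)
charPoly-expand M i = Σₛ-filterᵇ (λ B → subᵇ B (E M)) _

flatSum : ℕ → RMat n → Poly
flatSum f M = sumP (map (λ F → charPoly (localize M F) *P KLfuel f (contract M F))
                        (filterᵇ nonemptyᵇ (flats M)))

KLstep : ℕ → RMat n → ℕ → Poly
KLstep f M zero = if nonemptyᵇ (E M) then 0P else 1P
KLstep f M (suc k) i = if 2 *ℕ i <ᵇ suc k then - flatSum f M i else + 0

KLfuel-unfold : (f : ℕ) (M : RMat n) → KLfuel (suc f) M ≗ KLstep f M (rank M)
KLfuel-unfold f M i with rank M
... | zero = refl
... | suc k = refl

flatTerm : ℕ → RMat n → Subset n → ℕ → ℤ
flatTerm f M A i =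
  if isFlat M A
  then (if nonemptyᵇ A then (charPoly (localize M A) *P KLfuel f (contract M A)) i else + 0)
  else + 0

flatSum-expand : (f : ℕ) (M : RMat n) (i : ℕ) → flatSum f M i ≡ Σₛ (λ A → flatTerm f M A i)
flatSum-expand {n} f M i =
  trans (sumP-map-coeff term (filterᵇ nonemptyᵇ (flats M)) i)
        (trans (sumℤ-map-filterᵇ nonemptyᵇ (λ A → term A i) (flats M))
               (Σₛ-filterᵇ (isFlat M) _))
  where
  term : Subset n → Poly
  term F = charPoly (localize M F) *P KLfuel f (contract M F)

flatTerm-nonflat : (f : ℕ) (M : RMat n) (A : Subset n) → isFlat M A ≡ false → ∀ i → flatTerm f M A i ≡ + 0
flatTerm-nonflat f M A nonflat i rewrite nonflat = refl

flatTerm-empty : (f : ℕ) (M : RMat n) (A : Subset n) → nonemptyᵇ A ≡ false → ∀ i → flatTerm f M A i ≡ + 0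
flatTerm-empty f M A empty i rewrite empty with isFlat M A
... | true = refl
... | false = refl

flatTerm-flat : (f : ℕ) → IsFlat M A → ∀ {x} → x ∈ A → ∀ i →
  flatTerm f M A i ≡ (charPoly (localize M A) *P KLfuel f (contract M A)) i
flatTerm-flat f flat x∈A i rewrite IsFlat⇒isFlat flat | nonemptyᵇ-∈ x∈A = refl

Zterm : RMat n → Subset n → ℕ → ℤ
Zterm M A m = if isFlat M A then shiftP (r M A) (KL (contract M A)) m else + 0

Zpoly-expand : (M : RMat n) (m : ℕ) → Zpoly M m ≡ Σₛ (λ A → Zterm M A m)
Zpoly-expand M m =
  trans (sumP-map-coeff (λ F → shiftP (r M F) (KL (contract M F))) (flats M) m)
        (Σₛ-filterᵇ (isFlat M) _)

Zterm-nonflat : (M : RMat n) (A : Subset n) → isFlat M A ≡ false → ∀ m → Zterm M A m ≡ + 0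
Zterm-nonflat M A nonflat m rewrite nonflat = refl

Zterm-flat : IsFlat M A → ∀ m → Zterm M A m ≡ shiftP (r M A) (KL (contract M A)) m
Zterm-flat flat m rewrite IsFlat⇒isFlat flat = refl

record _≈ᴹ_ (M N : RMat n) : Set where
  field
    E-≡ : E M ≡ E N
    r-≡ : ∀ {A} → A ⊆ E M → r M A ≡ r N A
open _≈ᴹ_

rank-cong : M ≈ᴹ N → rank M ≡ rank N
rank-cong {N = N} M≈N = trans (r-≡ M≈N ⊆-refl) (cong (r N) (E-≡ M≈N))

localize-cong : M ≈ᴹ N → A ⊆ E M → localize M A ≈ᴹ localize N A
localize-cong M≈N A⊆E = record { E-≡ = refl ; r-≡ = λ B⊆A → r-≡ M≈N (⊆-trans B⊆A A⊆E) }

contract-cong : M ≈ᴹ N → A ⊆ E M → contract M A ≈ᴹ contract N A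
contract-cong {M = M} {A = A} M≈N A⊆E = record
  { E-≡ = cong (_─ A) (E-≡ M≈N)
  ; r-≡ = λ B⊆E─A → cong₂ _∸_ (r-≡ M≈N (∪-⊆ (⊆-trans B⊆E─A (p─q⊆p (E M) A)) A⊆E)) (r-≡ M≈N A⊆E)
  }

charPoly-cong : M ≈ᴹ N → charPoly M ≗ charPoly N
charPoly-cong {M = M} {N} M≈N i =
  trans (charPoly-expand M i) (trans (Σₛ-cong term-cong) (sym (charPoly-expand N i)))
  where
  term-cong : ∀ B → charTerm M i B ≡ charTerm N i B
  term-cong B with subᵇ B (E M) in B⊆E
  ... | false rewrite trans (cong (subᵇ B) (sym (E-≡ M≈N))) B⊆E = refl
  ... | true rewrite trans (cong (subᵇ B) (sym (E-≡ M≈N))) B⊆E =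
    cong₂ (λ a b → if a ∸ b ≡ᵇ i then sign ∣ B ∣ else + 0) (rank-cong M≈N) (r-≡ M≈N (subᵇ⇒⊆ B⊆E))

isFlat-≈ : M ≈ᴹ N → isFlat M A ≡ isFlat N A
isFlat-≈ {M = M} {N} M≈N = isFlat-cong M N (E-≡ M≈N) λ A⊆E →
  r-≡ M≈N A⊆E , λ x∈E _ → r-≡ M≈N (∪⁅x⁆-⊆ A⊆E x∈E)

KLfuel-cong : (f : ℕ) → M ≈ᴹ N → KLfuel f M ≗ KLfuel f N
KLfuel-cong zero _ _ = refl
KLfuel-cong {M = M} {N} (suc f) M≈N i = begin
  KLfuel (suc f) M i      ≡⟨ KLfuel-unfold f M i ⟩
  KLstep f M (rank M) i   ≡⟨ cong (λ k → KLstep f M k i) (rank-cong M≈N) ⟩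
  KLstep f M (rank N) i   ≡⟨ step-cong (rank N) ⟩
  KLstep f N (rank N) i   ≡⟨ KLfuel-unfold f N i ⟨
  KLfuel (suc f) N i      ∎
  where
  open ≡-Reasoning
  term-cong : ∀ A → flatTerm f M A i ≡ flatTerm f N A i
  term-cong A with isFlat M A in flat
  ... | false rewrite trans (sym (isFlat-≈ M≈N)) flat = refl
  ... | true rewrite trans (sym (isFlat-≈ M≈N)) flat =
    cong (if nonemptyᵇ A then_else + 0)
         (trans (*P-congˡ (KLfuel f (contract M A)) (charPoly-cong (localize-cong M≈N A⊆E)) i)
                (*P-congʳ (charPoly (localize N A)) (KLfuel-cong f (contract-cong M≈N A⊆E)) i))
    where
    A⊆E : A ⊆ E M
    A⊆E = IsFlat.⊆E (isFlat⇒IsFlat {M = M} flat)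
  step-cong : ∀ k → KLstep f M k i ≡ KLstep f N k i
  step-cong zero = cong (λ S → (if nonemptyᵇ S then 0P else 1P) i) (E-≡ M≈N)
  step-cong (suc k) = cong (λ s → if 2 *ℕ i <ᵇ suc k then - s else + 0)
    (trans (flatSum-expand f M i) (trans (Σₛ-cong term-cong) (sym (flatSum-expand f N i))))

KLfuel-rank0-empty : (f : ℕ) (M : RMat n) → rank M ≡ 0 → (∀ {x} → x ∉ E M) → KLfuel (suc f) M ≗ 1P
KLfuel-rank0-empty f M rank≡0 empty i =
  trans (KLfuel-unfold f M i)
        (trans (cong (λ k → KLstep f M k i) rank≡0)
               (cong (λ b → (if b then 0P else 1P) i) (nonemptyᵇ-empty empty)))

KLfuel-contract-E : (f : ℕ) (M : RMat n) → KLfuel (suc f) (contract M (E M)) ≗ 1P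
KLfuel-contract-E f M = KLfuel-rank0-empty f (contract M (E M)) rank≡0
  λ x∈E─E → x∈p─q⇒x∉q x∈E─E (p─q⊆p (E M) (E M) x∈E─E)
  where
  rank≡0 : r M ((E M ─ E M) ∪ E M) ∸ r M (E M) ≡ 0
  rank≡0 = trans (cong (λ S → r M S ∸ r M (E M)) (─∪≡ ⊆-refl)) (n∸n≡0 (r M (E M)))

-- the constant term of the characteristic polynomial of a loopless rank-1 matroid on h elements
binomialSum-rank1 : (h : ℕ) → 0 < h →
  binomialSum h (λ l → if 1 ∸ l ⊓ 1 ≡ᵇ 0 then sign l else + 0) ≡ - + 1
binomialSum-rank1 (suc h) _ = begin
  binomialSum (suc h) (λ l → if 1 ∸ l ⊓ 1 ≡ᵇ 0 then sign l else + 0)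
    ≡⟨ binomialSum-cong (suc h) (λ l _ → split l) ⟩
  binomialSum (suc h) (λ l → sign l + atZero l)
    ≡⟨ binomialSum-+ (suc h) sign atZero ⟩
  binomialSum (suc h) sign + binomialSum (suc h) atZero
    ≡⟨ cong₂ _+_ (binomialSum-sign (suc h)) (binomialSum-bottom (suc h) (- + 1)) ⟩
  - + 1 ∎
  where
  open ≡-Reasoning
  atZero : ℕ → ℤ
  atZero l = if l ≡ᵇ 0 then - + 1 else + 0
  split : ∀ l → (if 1 ∸ l ⊓ 1 ≡ᵇ 0 then sign l else + 0) ≡ sign l + atZero l
  split zero = refl
  split (suc zero) = refl
  split (suc (suc l)) = sym (ℤ.+-identityʳ (sign (suc (suc l))))

module _ (N : RMat n) (loopless-rank1 : ∀ {B} → B ⊆ E N → r N B ≡ ∣ B ∣ ⊓ 1) (E-nonempty : 0 < ∣ E N ∣) where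

  rank1-nonflat : A ⊆ E N → 0 < ∣ A ∣ → ∣ A ∣ < ∣ E N ∣ → isFlat N A ≡ false
  rank1-nonflat {A = A} A⊆E pos A<E with ∣<∣⇒∃ A<E
  ... | x , x∈E , x∉A = isFlat-nonclosed N A x∈E x∉A (≤-reflexive (trans rA∪x≡1 (sym rA≡1)))
    where
    rA∪x≡1 : r N (A ∪ ⁅ x ⁆) ≡ 1
    rA∪x≡1 = trans (loopless-rank1 (∪⁅x⁆-⊆ A⊆E x∈E))
                   (trans (cong (_⊓ 1) (∣∪⁅x⁆∣≡ x∉A)) (cong suc (⊓-zeroʳ ∣ A ∣)))
    rA≡1 : r N A ≡ 1
    rA≡1 = trans (loopless-rank1 A⊆E) (m≥n⇒m⊓n≡n pos)

  rank1 : rank N ≡ 1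
  rank1 = trans (loopless-rank1 ⊆-refl) (m≥n⇒m⊓n≡n E-nonempty)

  charPoly-rank1-0 : charPoly (localize N (E N)) 0 ≡ - + 1
  charPoly-rank1-0 = begin
    charPoly (localize N (E N)) 0                       ≡⟨ charPoly-expand (localize N (E N)) 0 ⟩
    Σₛ (charTerm (localize N (E N)) 0)                  ≡⟨ Σₛ-cong term ⟩
    Σₛ (λ B → if subᵇ B (E N) then c ∣ B ∣ else + 0)    ≡⟨ Σₛ-⊆-by-size (E N) c ⟩
    binomialSum ∣ E N ∣ c                               ≡⟨ binomialSum-rank1 ∣ E N ∣ E-nonempty ⟩
    - + 1                                               ∎
    where
    open ≡-Reasoning
    c : ℕ → ℤ
    c l = if 1 ∸ l ⊓ 1 ≡ᵇ 0 then sign l else + 0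
    term : ∀ B → charTerm (localize N (E N)) 0 B ≡ (if subᵇ B (E N) then c ∣ B ∣ else + 0)
    term B with subᵇ B (E N) in B⊆E
    ... | false = refl
    ... | true = cong₂ (λ a b → if a ∸ b ≡ᵇ 0 then sign ∣ B ∣ else + 0) rank1 (loopless-rank1 (subᵇ⇒⊆ B⊆E))

  flatTerm-rank1-E : (f : ℕ) → flatTerm (suc f) N (E N) 0 ≡ - + 1
  flatTerm-rank1-E f with ∣∣>0⇒∃ E-nonempty
  ... | x , x∈E = begin
    flatTerm (suc f) N (E N) 0                              ≡⟨ flatTerm-flat (suc f) (IsFlat-E N) x∈E 0 ⟩
    (χ-E *P KLfuel (suc f) (contract N (E N))) 0            ≡⟨ *P-congʳ χ-E (KLfuel-contract-E f N) 0 ⟩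
    (χ-E *P 1P) 0                                           ≡⟨ *P-identityʳ χ-E 0 ⟩
    χ-E 0                                                   ≡⟨ charPoly-rank1-0 ⟩
    - + 1                                                   ∎
    where
    open ≡-Reasoning
    χ-E : Poly
    χ-E = charPoly (localize N (E N))

  -- E is the only nonempty flat
  flatTerm-rank1 : (f : ℕ) (A : Subset n) →
    flatTerm (suc f) N A 0 ≡ (if subᵇ A (E N) then (if ∣ A ∣ ≡ᵇ ∣ E N ∣ then - + 1 else + 0) else + 0)
  flatTerm-rank1 f A with A ⊆? E N
  ... | no A⊈E = trans (flatTerm-nonflat (suc f) N A (isFlat-⊈ N A A⊈E) 0) (sym (if-false (⊈⇒subᵇ A⊈E)))
  ... | yes A⊆E = trans (inside (∣ A ∣ ≟ ∣ E N ∣)) (sym (if-true (⊆⇒subᵇ A⊆E)))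
    where
    inside : Dec (∣ A ∣ ≡ ∣ E N ∣) → flatTerm (suc f) N A 0 ≡ (if ∣ A ∣ ≡ᵇ ∣ E N ∣ then - + 1 else + 0)
    inside (yes size≡) =
      trans (cong (λ S → flatTerm (suc f) N S 0) (⊆∧∣≥∣⇒≡ A⊆E (≤-reflexive (sym size≡))))
            (trans (flatTerm-rank1-E f) (sym (if-true (≡⇒≡ᵇ≡true size≡))))
    inside (no size≢) = trans (outside (0 <? ∣ A ∣)) (sym (if-false (≢⇒≡ᵇ≡false size≢)))
      where
      outside : Dec (0 < ∣ A ∣) → flatTerm (suc f) N A 0 ≡ + 0
      outside (yes pos) = flatTerm-nonflat (suc f) N A
        (rank1-nonflat A⊆E pos (≤∧≢⇒< (p⊆q⇒∣p∣≤∣q∣ A⊆E) size≢)) 0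
      outside (no ¬pos) = flatTerm-empty (suc f) N A (nonemptyᵇ-empty {A = A} (¬pos ∘ ∈⇒∣∣>0)) 0

  flatSum-rank1-0 : (f : ℕ) → flatSum (suc f) N 0 ≡ - + 1
  flatSum-rank1-0 f = trans (flatSum-expand (suc f) N 0)
    (trans (Σₛ-cong (flatTerm-rank1 f)) (trans (Σₛ-⊆-by-size (E N) _) (binomialSum-top ∣ E N ∣ (- + 1))))

  KLfuel-rank1 : (f : ℕ) → ∣ E N ∣ ≤ f → KLfuel (suc f) N ≗ 1P
  KLfuel-rank1 zero E≤0 = contradiction E≤0 (<⇒≱ E-nonempty)
  KLfuel-rank1 (suc f) _ i =
    trans (KLfuel-unfold (suc f) N i) (trans (cong (λ k → KLstep (suc f) N k i) rank1) (step i))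
    where
    step : ∀ i → KLstep (suc f) N 1 i ≡ 1P i
    step zero = cong -_ (flatSum-rank1-0 f)
    step (suc i) = refl

KLfuel-contract-rank1 : (f : ℕ) (N : RMat n) → A ⊆ E N → 0 < ∣ E N ─ A ∣ → ∣ E N ─ A ∣ ≤ f →
  (∀ {B} → B ⊆ E N ─ A → 0 < ∣ B ∣ → r N (B ∪ A) ≡ suc (r N A)) →
  KLfuel (suc f) (contract N A) ≗ 1P
KLfuel-contract-rank1 {A = A} f N A⊆E pos small jump =
  KLfuel-rank1 (contract N A) loopless-rank1 pos f small
  where
  loopless-rank1 : ∀ {B} → B ⊆ E N ─ A → r N (B ∪ A) ∸ r N A ≡ ∣ B ∣ ⊓ 1
  loopless-rank1 {B} B⊆ with ∣ B ∣ in size≡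
  ... | zero = trans (cong (λ S → r N S ∸ r N A) (empty-∪ (∣∣≡0⇒∉ size≡))) (n∸n≡0 (r N A))
  ... | suc b = trans (cong (_∸ r N A) (jump B⊆ (subst (0 <_) (sym size≡) (s≤s z≤n))))
                      (trans (m+n∸n≡m 1 (r N A)) (sym (cong suc (⊓-zeroʳ b))))

-- Stressed hyperplanes

<⇒≤∸1 : ∀ {j k} → j < k → j ≤ k ∸ 1
<⇒≤∸1 {k = suc k} (s≤s le) = le

0<⇒suc[∸1] : ∀ {k} → 0 < k → suc (k ∸ 1) ≡ k
0<⇒suc[∸1] {suc k} _ = refl

<⇒⊓[∸1]≡ : ∀ {a k} → a < k → a ⊓ (k ∸ 1) ≡ a
<⇒⊓[∸1]≡ = m≤n⇒m⊓n≡m ∘ <⇒≤∸1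

≤1+⇒⊓[∸1]≡ : ∀ {a k} → k ≤ suc a → a ⊓ (k ∸ 1) ≡ k ∸ 1
≤1+⇒⊓[∸1]≡ {a} {zero} _ = ⊓-zeroʳ a
≤1+⇒⊓[∸1]≡ {k = suc k} (s≤s le) = m≥n⇒m⊓n≡n le

[m+j]⊓[k∸1]∸j : ∀ m j k → ((m +ℕ j) ⊓ (k ∸ 1)) ∸ j ≡ m ⊓ ((k ∸ j) ∸ 1)
[m+j]⊓[k∸1]∸j m j k = begin
  ((m +ℕ j) ⊓ (k ∸ 1)) ∸ j      ≡⟨ ∸-distribʳ-⊓ j (m +ℕ j) (k ∸ 1) ⟩
  (m +ℕ j ∸ j) ⊓ (k ∸ 1 ∸ j)   ≡⟨ cong₂ _⊓_ (m+n∸n≡m m j) (∸-+-assoc k 1 j) ⟩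
  m ⊓ (k ∸ (1 +ℕ j))            ≡⟨ cong (λ l → m ⊓ (k ∸ l)) (+-comm 1 j) ⟩
  m ⊓ (k ∸ (j +ℕ 1))            ≡⟨ cong (m ⊓_) (sym (∸-+-assoc k j 1)) ⟩
  m ⊓ ((k ∸ j) ∸ 1)             ∎
  where open ≡-Reasoning

suc[[m+j]⊓[k∸1]]∸j : ∀ m {j k} → j < k → suc ((m +ℕ j) ⊓ (k ∸ 1)) ∸ j ≡ suc (m ⊓ ((k ∸ j) ∸ 1))
suc[[m+j]⊓[k∸1]]∸j m {j} {k} j<k =
  trans (+-∸-assoc 1 (⊓-glb (m≤n+m j m) (<⇒≤∸1 j<k))) (cong suc ([m+j]⊓[k∸1]∸j m j k))

-- Whitney's formula for the uniform matroid of rank j ⊓ (k − 1) on j elements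
uniformCharPoly : ℕ → ℕ → Poly
uniformCharPoly k j i =
  binomialSum j (λ l → if (j ⊓ (k ∸ 1)) ∸ (l ⊓ (k ∸ 1)) ≡ᵇ i then sign l else + 0)

-- The rank-function form of "H is a stressed hyperplane of the rank-k matroid M": M
-- restricted to H is uniform of rank k − 1 and every element outside H raises the rank of
-- every subset of H.  Unlike the basis form, it is inherited by contractions by small
-- subsets of H.
record StressedHyperplane (M : RMat n) (k : ℕ) (H : Subset n) : Set where
  field
    k-pos : 0 < k
    H-nonempty : 0 < ∣ H ∣
    k≤1+∣H∣ : k ≤ suc ∣ H ∣
    H⊆E : H ⊆ E M
    rank≡k : rank M ≡ k
    r-⊆H : ∀ {B} → B ⊆ H → r M B ≡ ∣ B ∣ ⊓ (k ∸ 1)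
    r-⊆H∪⁅x⁆ : ∀ {B x} → B ⊆ H → x ∈ E M → x ∉ H → r M (B ∪ ⁅ x ⁆) ≡ suc (∣ B ∣ ⊓ (k ∸ 1))
    r-mono : ∀ {A B} → A ⊆ B → B ⊆ E M → r M A ≤ r M B

module StressedHyperplaneProperties {M : RMat n} {k : ℕ} {H : Subset n}
                                    (S : StressedHyperplane M k H) where
  open StressedHyperplane S

  r-H : r M H ≡ k ∸ 1
  r-H = trans (r-⊆H ⊆-refl) (≤1+⇒⊓[∸1]≡ k≤1+∣H∣)

  ∃-outside : ∃[ x ] x ∈ E M × x ∉ H
  ∃-outside = ⊈⇒∃ λ E⊆H → <-irrefl refl (begin-strict
    k                      ≡⟨ sym rank≡k ⟩
    r M (E M)              ≡⟨ r-⊆H E⊆H ⟩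
    ∣ E M ∣ ⊓ (k ∸ 1)      ≤⟨ m⊓n≤n ∣ E M ∣ (k ∸ 1) ⟩
    k ∸ 1                  <⟨ ≤-reflexive (0<⇒suc[∸1] k-pos) ⟩
    k                      ∎)
    where open ≤-Reasoning

  r-spanning : ∀ {S T y} → S ⊆ E M → T ⊆ H → T ⊆ S → y ∈ S → y ∉ H → k ≤ suc ∣ T ∣ → r M S ≡ k
  r-spanning {S} {T} {y} S⊆E T⊆H T⊆S y∈S y∉H k≤ = ≤-antisym upper lower
    where
    open ≤-Reasoning
    upper : r M S ≤ k
    upper = ≤-trans (r-mono S⊆E ⊆-refl) (≤-reflexive rank≡k)
    lower : k ≤ r M S
    lower = begin
      k                              ≡⟨ sym (0<⇒suc[∸1] k-pos) ⟩
      suc (k ∸ 1)                    ≡⟨ cong suc (sym (≤1+⇒⊓[∸1]≡ k≤)) ⟩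
      suc (∣ T ∣ ⊓ (k ∸ 1))          ≡⟨ sym (r-⊆H∪⁅x⁆ T⊆H (S⊆E y∈S) y∉H) ⟩
      r M (T ∪ ⁅ y ⁆)                ≤⟨ r-mono (∪⁅x⁆-⊆ T⊆S y∈S) S⊆E ⟩
      r M S                          ∎

  IsFlat-small : ∀ {A} → A ⊆ H → 2 +ℕ ∣ A ∣ ≤ k → IsFlat M A
  IsFlat-small {A} A⊆H 2+a≤k = mkIsFlat (⊆-trans A⊆H H⊆E) closed
    where
    a<k : ∣ A ∣ < k
    a<k = ≤-trans (n≤1+n _) 2+a≤k
    r-A : r M A ≡ ∣ A ∣
    r-A = trans (r-⊆H A⊆H) (<⇒⊓[∸1]≡ a<k)
    closed : ∀ {x} → x ∈ E M → x ∉ A → r M A < r M (A ∪ ⁅ x ⁆)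
    closed {x} x∈E x∉A with x ∈? H
    ... | yes x∈H = ≤-reflexive (sym (begin
      r M (A ∪ ⁅ x ⁆)                ≡⟨ r-⊆H (∪⁅x⁆-⊆ A⊆H x∈H) ⟩
      ∣ A ∪ ⁅ x ⁆ ∣ ⊓ (k ∸ 1)        ≡⟨ cong (_⊓ (k ∸ 1)) (∣∪⁅x⁆∣≡ x∉A) ⟩
      suc ∣ A ∣ ⊓ (k ∸ 1)            ≡⟨ <⇒⊓[∸1]≡ 2+a≤k ⟩
      suc ∣ A ∣                      ≡⟨ cong suc (sym r-A) ⟩
      suc (r M A)                    ∎))
      where open ≡-Reasoning
    ... | no x∉H = ≤-reflexive (sym (trans (r-⊆H∪⁅x⁆ A⊆H x∈E x∉H) (cong suc (sym (r-⊆H A⊆H)))))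

  IsFlat-H : IsFlat M H
  IsFlat-H = mkIsFlat H⊆E λ x∈E x∉H →
    ≤-reflexive (sym (trans (r-⊆H∪⁅x⁆ ⊆-refl x∈E x∉H) (cong suc (sym (r-⊆H ⊆-refl)))))

  isFlat-large : ∀ {A} → A ⊆ H → k ≤ suc ∣ A ∣ → ∣ A ∣ ≢ ∣ H ∣ → isFlat M A ≡ false
  isFlat-large {A} A⊆H k≤ a≢h with ∣<∣⇒∃ (≤∧≢⇒< (p⊆q⇒∣p∣≤∣q∣ A⊆H) a≢h)
  ... | y , y∈H , y∉A = isFlat-nonclosed M A (H⊆E y∈H) y∉A (≤-reflexive (begin
    r M (A ∪ ⁅ y ⁆)            ≡⟨ r-⊆H (∪⁅x⁆-⊆ A⊆H y∈H) ⟩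
    ∣ A ∪ ⁅ y ⁆ ∣ ⊓ (k ∸ 1)    ≡⟨ cong (_⊓ (k ∸ 1)) (∣∪⁅x⁆∣≡ y∉A) ⟩
    suc ∣ A ∣ ⊓ (k ∸ 1)        ≡⟨ ≤1+⇒⊓[∸1]≡ (m≤n⇒m≤1+n k≤) ⟩
    k ∸ 1                      ≡⟨ sym (≤1+⇒⊓[∸1]≡ k≤) ⟩
    ∣ A ∣ ⊓ (k ∸ 1)            ≡⟨ sym (r-⊆H A⊆H) ⟩
    r M A                      ∎))
    where open ≡-Reasoning

  ⊆H∩flat-small : ∀ {A B} → IsFlat M A → A ⊈ H → ∣ A ∣ < ∣ E M ∣ → B ⊆ A → B ⊆ H → ∣ B ∣ < k
  ⊆H∩flat-small {A} {B} (mkIsFlat A⊆E closed) A⊈H A<E B⊆A B⊆H with k ≤? ∣ B ∣ | ⊈⇒∃ A⊈H | ∣<∣⇒∃ A<E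
  ... | no k≰b | _ | _ = ≰⇒> k≰b
  ... | yes k≤b | x , x∈A , x∉H | y , y∈E , y∉A =
    contradiction (≤-trans (r-mono (∪⁅x⁆-⊆ A⊆E y∈E) ⊆-refl) (≤-reflexive rank≡k))
                  (<⇒≱ (subst (_< r M (A ∪ ⁅ y ⁆)) r-A≡k (closed y∈E y∉A)))
    where
    r-A≡k : r M A ≡ k
    r-A≡k = r-spanning A⊆E B⊆H B⊆A x∈A x∉H (m≤n⇒m≤1+n k≤b)

  KLfuel-contract-H : (f : ℕ) → ∣ E M ─ H ∣ ≤ f → KLfuel (suc f) (contract M H) ≗ 1P
  KLfuel-contract-H f small = KLfuel-contract-rank1 f M H⊆E nonempty small jump
    where
    nonempty : 0 < ∣ E M ─ H ∣
    nonempty with ∃-outside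
    ... | x , x∈E , x∉H = ∈⇒∣∣>0 (x∈p∧x∉q⇒x∈p─q x∈E x∉H)
    jump : ∀ {B} → B ⊆ E M ─ H → 0 < ∣ B ∣ → r M (B ∪ H) ≡ suc (r M H)
    jump {B} B⊆ pos with ∣∣>0⇒∃ pos
    ... | y , y∈B = trans (r-spanning (∪-⊆ (⊆-trans B⊆ (p─q⊆p _ _)) H⊆E) ⊆-refl (q⊆p∪q B H)
                                      (p⊆p∪q H y∈B) (x∈p─q⇒x∉q (B⊆ y∈B)) k≤1+∣H∣)
                          (sym (trans (cong suc r-H) (0<⇒suc[∸1] k-pos)))

  charPoly-localize-⊆H : ∀ {A} → A ⊆ H → charPoly (localize M A) ≗ uniformCharPoly k ∣ A ∣
  charPoly-localize-⊆H {A} A⊆H i =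
    trans (charPoly-expand (localize M A) i) (trans (Σₛ-cong term) (Σₛ-⊆-by-size A _))
    where
    term : ∀ B → charTerm (localize M A) i B ≡
                 (if subᵇ B A then (if (∣ A ∣ ⊓ (k ∸ 1)) ∸ (∣ B ∣ ⊓ (k ∸ 1)) ≡ᵇ i then sign ∣ B ∣ else + 0) else + 0)
    term B with subᵇ B A in B⊆A
    ... | false = refl
    ... | true = cong₂ (λ a b → if a ∸ b ≡ᵇ i then sign ∣ B ∣ else + 0)
                       (r-⊆H A⊆H) (r-⊆H (⊆-trans (subᵇ⇒⊆ B⊆A) A⊆H))

  module _ {A : Subset n} (A⊆H : A ⊆ H) (2+j≤k : 2 +ℕ ∣ A ∣ ≤ k) where
    private
      j : ℕ
      j = ∣ A ∣
      A⊆E : A ⊆ E M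
      A⊆E = ⊆-trans A⊆H H⊆E
      j<k : j < k
      j<k = ≤-trans (n≤1+n _) 2+j≤k

    r-small : r M A ≡ j
    r-small = trans (r-⊆H A⊆H) (<⇒⊓[∸1]≡ j<k)

    ∣H─A∣+j≡∣H∣ : ∣ H ─ A ∣ +ℕ j ≡ ∣ H ∣
    ∣H─A∣+j≡∣H∣ = ∣─∣+∣∣≡ A⊆H

    ∣H─A∣≡ : ∣ H ─ A ∣ ≡ ∣ H ∣ ∸ j
    ∣H─A∣≡ = trans (sym (m+n∸n≡m _ j)) (cong (_∸ j) ∣H─A∣+j≡∣H∣)

    H─A⊆E─A : H ─ A ⊆ E M ─ A
    H─A⊆E─A x∈H─A = x∈p∧x∉q⇒x∈p─q (H⊆E (p─q⊆p H A x∈H─A)) (x∈p─q⇒x∉q x∈H─A)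

    ∪A-⊆H : ∀ {B} → B ⊆ H ─ A → B ∪ A ⊆ H
    ∪A-⊆H B⊆ = ∪-⊆ (⊆-trans B⊆ (p─q⊆p H A)) A⊆H

    ∪A-⊆E : ∀ {B} → B ⊆ E M ─ A → B ∪ A ⊆ E M
    ∪A-⊆E B⊆ = ∪-⊆ (⊆-trans B⊆ (p─q⊆p (E M) A)) A⊆E

    ∣∪A∣ : ∀ {B} → B ⊆ E M ─ A → ∣ B ∪ A ∣ ≡ ∣ B ∣ +ℕ j
    ∣∪A∣ B⊆ = ∣∪∣-disjoint (x∈p─q⇒x∉q ∘ B⊆)

    ∪⁅x⁆-∪A : ∀ B x → (B ∪ ⁅ x ⁆) ∪ A ≡ (B ∪ A) ∪ ⁅ x ⁆
    ∪⁅x⁆-∪A B x = begin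
      (B ∪ ⁅ x ⁆) ∪ A    ≡⟨ ∪-assoc B ⁅ x ⁆ A ⟩
      B ∪ (⁅ x ⁆ ∪ A)    ≡⟨ cong (B ∪_) (∪-comm ⁅ x ⁆ A) ⟩
      B ∪ (A ∪ ⁅ x ⁆)    ≡⟨ ∪-assoc B A ⁅ x ⁆ ⟨
      (B ∪ A) ∪ ⁅ x ⁆    ∎
      where open ≡-Reasoning

    contract-stressed : StressedHyperplane (contract M A) (k ∸ j) (H ─ A)
    contract-stressed = record
      { k-pos = m+n≤o⇒m≤o∸n 1 j<k
      ; H-nonempty = n≢0⇒n>0 λ ∣H─A∣≡0 → <-irrefl refl (≤-trans 2+j≤k (≤-trans k≤1+∣H∣
          (s≤s (≤-reflexive (trans (sym ∣H─A∣+j≡∣H∣) (cong (_+ℕ j) ∣H─A∣≡0))))))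
      ; k≤1+∣H∣ = m≤n+o⇒m∸n≤o k j (≤-trans k≤1+∣H∣ (≤-reflexive (begin
          suc ∣ H ∣                   ≡⟨ cong suc (sym ∣H─A∣+j≡∣H∣) ⟩
          suc (∣ H ─ A ∣ +ℕ j)        ≡⟨ cong suc (+-comm ∣ H ─ A ∣ j) ⟩
          suc (j +ℕ ∣ H ─ A ∣)        ≡⟨ sym (+-suc j _) ⟩
          j +ℕ suc ∣ H ─ A ∣          ∎)))
      ; H⊆E = H─A⊆E─A
      ; rank≡k = trans (cong₂ _∸_ (cong (r M) (─∪≡ A⊆E)) r-small) (cong (_∸ j) rank≡k)
      ; r-⊆H = λ {B} B⊆ → begin
          r M (B ∪ A) ∸ r M A                     ≡⟨ cong₂ _∸_ (r-⊆H (∪A-⊆H B⊆)) r-small ⟩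
          (∣ B ∪ A ∣ ⊓ (k ∸ 1)) ∸ j               ≡⟨ cong (λ c → (c ⊓ (k ∸ 1)) ∸ j) (∣∪A∣ (⊆-trans B⊆ H─A⊆E─A)) ⟩
          ((∣ B ∣ +ℕ j) ⊓ (k ∸ 1)) ∸ j            ≡⟨ [m+j]⊓[k∸1]∸j ∣ B ∣ j k ⟩
          ∣ B ∣ ⊓ ((k ∸ j) ∸ 1)                   ∎
      ; r-⊆H∪⁅x⁆ = λ {B} {x} B⊆ x∈E─A x∉H─A → begin
          r M ((B ∪ ⁅ x ⁆) ∪ A) ∸ r M A           ≡⟨ cong₂ _∸_ (cong (r M) (∪⁅x⁆-∪A B x)) r-small ⟩
          r M ((B ∪ A) ∪ ⁅ x ⁆) ∸ j               ≡⟨ cong (_∸ j) (r-⊆H∪⁅x⁆ (∪A-⊆H B⊆) (p─q⊆p (E M) A x∈E─A)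
                                                       λ x∈H → x∉H─A (x∈p∧x∉q⇒x∈p─q x∈H (x∈p─q⇒x∉q x∈E─A))) ⟩
          suc (∣ B ∪ A ∣ ⊓ (k ∸ 1)) ∸ j           ≡⟨ cong (λ c → suc (c ⊓ (k ∸ 1)) ∸ j) (∣∪A∣ (⊆-trans B⊆ H─A⊆E─A)) ⟩
          suc ((∣ B ∣ +ℕ j) ⊓ (k ∸ 1)) ∸ j        ≡⟨ suc[[m+j]⊓[k∸1]]∸j ∣ B ∣ j<k ⟩
          suc (∣ B ∣ ⊓ ((k ∸ j) ∸ 1))             ∎
      ; r-mono = λ {B} {B′} B⊆B′ B′⊆ → ∸-monoˡ-≤ (r M A)
          (r-mono (∪-⊆ (⊆-trans B⊆B′ (p⊆p∪q A)) (q⊆p∪q B′ A)) (∪A-⊆E B′⊆))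
      }
      where open ≡-Reasoning

-- Relaxation

record Relaxation (M : RMat n) (k : ℕ) (H : Subset n) (M′ : RMat n) : Set where
  field
    E′≡E : E M′ ≡ E M
    r′-large : ∀ {A} → A ⊆ H → k ≤ ∣ A ∣ → r M′ A ≡ k
    r′-⊈H : ∀ {A} → A ⊆ E M → A ⊈ H → r M′ A ≡ r M A
    r′-small : ∀ {A} → A ⊆ E M → ∣ A ∣ < k → r M′ A ≡ r M A

-- the change of the Whitney term (coefficient of t^i) of a size-l subset of H under relaxation
χ-relax-term : ℕ → ℕ → ℕ → ℤ
χ-relax-term k i l =
  if k ≤ᵇ l then (if 0 ≡ᵇ i then sign l else + 0) - (if 1 ≡ᵇ i then sign l else + 0) else + 0

χ-relax-defect : ℕ → ℕ → Poly
χ-relax-defect k h i = binomialSum h (χ-relax-term k i)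

module RelaxationProperties {M M′ : RMat n} {k : ℕ} {H : Subset n}
                            (S : StressedHyperplane M k H) (R : Relaxation M k H M′) where
  open StressedHyperplane S
  open StressedHyperplaneProperties S
  open Relaxation R

  E⊈H : E M ⊈ H
  E⊈H E⊆H with ∃-outside
  ... | x , x∈E , x∉H = x∉H (E⊆H x∈E)

  r′-E : r M′ (E M) ≡ k
  r′-E = trans (r′-⊈H ⊆-refl E⊈H) rank≡k

  rank′≡k : rank M′ ≡ k
  rank′≡k = trans (cong (r M′) E′≡E) r′-E

  isFlat′-⊈H : ∀ {A} → A ⊈ H → isFlat M′ A ≡ isFlat M A
  isFlat′-⊈H {A} A⊈H = isFlat-cong M′ M E′≡E λ A⊆E′ →
    let A⊆E = subst (A ⊆_) E′≡E A⊆E′ in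
    r′-⊈H A⊆E A⊈H ,
    λ x∈E′ _ → r′-⊈H (∪⁅x⁆-⊆ A⊆E (subst (_ ∈_) E′≡E x∈E′)) (λ A∪x⊆H → A⊈H (⊆-trans (p⊆p∪q _) A∪x⊆H))

  isFlat′-small : ∀ {A} → 2 +ℕ ∣ A ∣ ≤ k → isFlat M′ A ≡ isFlat M A
  isFlat′-small {A} 2+a≤k = isFlat-cong M′ M E′≡E λ A⊆E′ →
    let A⊆E = subst (A ⊆_) E′≡E A⊆E′ in
    r′-small A⊆E (≤-trans (n≤1+n _) 2+a≤k) ,
    λ {x} x∈E′ _ → r′-small (∪⁅x⁆-⊆ A⊆E (subst (_ ∈_) E′≡E x∈E′))
                            (≤-trans (s≤s (∣∪⁅x⁆∣≤ A x)) 2+a≤k)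

  IsFlat′-⊈H : ∀ {A} → A ⊈ H → IsFlat M A → IsFlat M′ A
  IsFlat′-⊈H A⊈H flat = isFlat⇒IsFlat (trans (isFlat′-⊈H A⊈H) (IsFlat⇒isFlat flat))

  IsFlat′-small : ∀ {A} → 2 +ℕ ∣ A ∣ ≤ k → IsFlat M A → IsFlat M′ A
  IsFlat′-small 2+a≤k flat = isFlat⇒IsFlat (trans (isFlat′-small 2+a≤k) (IsFlat⇒isFlat flat))

  r′-corank1 : ∀ {A} → A ⊆ H → suc ∣ A ∣ ≡ k → r M′ A ≡ ∣ A ∣
  r′-corank1 A⊆H 1+a≡k = trans (r′-small (⊆-trans A⊆H H⊆E) (≤-reflexive 1+a≡k))
                               (trans (r-⊆H A⊆H) (<⇒⊓[∸1]≡ (≤-reflexive 1+a≡k)))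

  IsFlat′-corank1 : ∀ {A} → A ⊆ H → suc ∣ A ∣ ≡ k → IsFlat M′ A
  IsFlat′-corank1 {A} A⊆H 1+a≡k = mkIsFlat (subst (A ⊆_) (sym E′≡E) A⊆E) closed
    where
    A⊆E : A ⊆ E M
    A⊆E = ⊆-trans A⊆H H⊆E
    closed : ∀ {x} → x ∈ E M′ → x ∉ A → r M′ A < r M′ (A ∪ ⁅ x ⁆)
    closed {x} x∈E′ x∉A with x ∈? H
    ... | yes x∈H = ≤-reflexive (sym (begin
      r M′ (A ∪ ⁅ x ⁆)     ≡⟨ r′-large (∪⁅x⁆-⊆ A⊆H x∈H) (≤-reflexive (trans (sym 1+a≡k) (sym (∣∪⁅x⁆∣≡ x∉A)))) ⟩
      k                    ≡⟨ sym 1+a≡k ⟩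
      suc ∣ A ∣            ≡⟨ cong suc (sym (r′-corank1 A⊆H 1+a≡k)) ⟩
      suc (r M′ A)         ∎))
      where open ≡-Reasoning
    ... | no x∉H = ≤-reflexive (sym (begin
      r M′ (A ∪ ⁅ x ⁆)              ≡⟨ r′-⊈H (∪⁅x⁆-⊆ A⊆E x∈E) (λ A∪x⊆H → x∉H (A∪x⊆H (q⊆p∪q A ⁅ x ⁆ (x∈⁅x⁆ x)))) ⟩
      r M (A ∪ ⁅ x ⁆)               ≡⟨ r-⊆H∪⁅x⁆ A⊆H x∈E x∉H ⟩
      suc (∣ A ∣ ⊓ (k ∸ 1))         ≡⟨ cong suc (<⇒⊓[∸1]≡ (≤-reflexive 1+a≡k)) ⟩
      suc ∣ A ∣                     ≡⟨ cong suc (sym (r′-corank1 A⊆H 1+a≡k)) ⟩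
      suc (r M′ A)                  ∎))
      where
      open ≡-Reasoning
      x∈E : x ∈ E M
      x∈E = subst (_ ∈_) E′≡E x∈E′

  isFlat′-large : ∀ {A} → A ⊆ H → k ≤ ∣ A ∣ → isFlat M′ A ≡ false
  isFlat′-large {A} A⊆H k≤a with ∃-outside
  ... | x , x∈E , x∉H = isFlat-nonclosed M′ A (subst (_ ∈_) (sym E′≡E) x∈E) (x∉H ∘ A⊆H) (≤-reflexive (begin
    r M′ (A ∪ ⁅ x ⁆)          ≡⟨ r′-⊈H (∪⁅x⁆-⊆ A⊆E x∈E) (λ A∪x⊆H → x∉H (A∪x⊆H (q⊆p∪q A ⁅ x ⁆ (x∈⁅x⁆ x)))) ⟩
    r M (A ∪ ⁅ x ⁆)           ≡⟨ r-⊆H∪⁅x⁆ A⊆H x∈E x∉H ⟩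
    suc (∣ A ∣ ⊓ (k ∸ 1))     ≡⟨ cong suc (≤1+⇒⊓[∸1]≡ (m≤n⇒m≤1+n k≤a)) ⟩
    suc (k ∸ 1)               ≡⟨ 0<⇒suc[∸1] k-pos ⟩
    k                         ≡⟨ sym (r′-large A⊆H k≤a) ⟩
    r M′ A                    ∎))
    where
    open ≡-Reasoning
    A⊆E : A ⊆ E M
    A⊆E = ⊆-trans A⊆H H⊆E

  charPoly′-localize-⊆H : ∀ {A} → A ⊆ H → ∣ A ∣ < k → charPoly (localize M′ A) ≗ uniformCharPoly k ∣ A ∣
  charPoly′-localize-⊆H {A} A⊆H a<k i =
    trans (charPoly-cong localize≈ i) (charPoly-localize-⊆H A⊆H i)
    where
    localize≈ : localize M′ A ≈ᴹ localize M A
    localize≈ = record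
      { E-≡ = refl
      ; r-≡ = λ B⊆A → r′-small (⊆-trans B⊆A (⊆-trans A⊆H H⊆E)) (≤-<-trans (p⊆q⇒∣p∣≤∣q∣ B⊆A) a<k)
      }

  localize′-flat-⊈H : ∀ {A} → IsFlat M A → A ⊈ H → ∣ A ∣ < ∣ E M ∣ → localize M′ A ≈ᴹ localize M A
  localize′-flat-⊈H {A} flat A⊈H A<E = record { E-≡ = refl ; r-≡ = r-≡′ }
    where
    r-≡′ : ∀ {B} → B ⊆ A → r M′ B ≡ r M B
    r-≡′ {B} B⊆A with B ⊆? H
    ... | yes B⊆H = r′-small B⊆E (⊆H∩flat-small flat A⊈H A<E B⊆A B⊆H)
      where
      B⊆E : B ⊆ E M
      B⊆E = ⊆-trans B⊆A (IsFlat.⊆E flat)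
    ... | no B⊈H = r′-⊈H (⊆-trans B⊆A (IsFlat.⊆E flat)) B⊈H

  contract′-⊈H : ∀ {A} → A ⊆ E M → A ⊈ H → contract M′ A ≈ᴹ contract M A
  contract′-⊈H {A} A⊆E A⊈H = record
    { E-≡ = cong (_─ A) E′≡E
    ; r-≡ = λ B⊆ → cong₂ _∸_
        (r′-⊈H (∪-⊆ (⊆-trans B⊆ (⊆-trans (p─q⊆p _ A) (subst (_ ⊆_) E′≡E ⊆-refl))) A⊆E)
               (λ B∪A⊆H → A⊈H (⊆-trans (q⊆p∪q _ A) B∪A⊆H)))
        (r′-⊈H A⊆E A⊈H)
    }

  KLfuel′-contract-corank1 : ∀ {A} (f : ℕ) → A ⊆ H → suc ∣ A ∣ ≡ k → ∣ E M ─ A ∣ ≤ f →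
    KLfuel (suc f) (contract M′ A) ≗ 1P
  KLfuel′-contract-corank1 {A} f A⊆H 1+a≡k small =
    KLfuel-contract-rank1 f M′ (subst (A ⊆_) (sym E′≡E) A⊆E) nonempty
      (subst (λ S → ∣ S ─ A ∣ ≤ f) (sym E′≡E) small) jump
    where
    A⊆E : A ⊆ E M
    A⊆E = ⊆-trans A⊆H H⊆E
    nonempty : 0 < ∣ E M′ ─ A ∣
    nonempty with ∃-outside
    ... | x , x∈E , x∉H = ∈⇒∣∣>0 (x∈p∧x∉q⇒x∈p─q (subst (_ ∈_) (sym E′≡E) x∈E) (x∉H ∘ A⊆H))
    jump : ∀ {B} → B ⊆ E M′ ─ A → 0 < ∣ B ∣ → r M′ (B ∪ A) ≡ suc (r M′ A)
    jump {B} B⊆ pos with B ∪ A ⊆? H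
    ... | yes B∪A⊆H = trans (r′-large B∪A⊆H k≤) (trans (sym 1+a≡k) (cong suc (sym (r′-corank1 A⊆H 1+a≡k))))
      where
      k≤ : k ≤ ∣ B ∪ A ∣
      k≤ = begin
        k                   ≡⟨ sym 1+a≡k ⟩
        1 +ℕ ∣ A ∣          ≤⟨ +-monoˡ-≤ ∣ A ∣ pos ⟩
        ∣ B ∣ +ℕ ∣ A ∣      ≡⟨ sym (∣∪∣-disjoint (x∈p─q⇒x∉q ∘ B⊆)) ⟩
        ∣ B ∪ A ∣           ∎
        where open ≤-Reasoning
    ... | no B∪A⊈H with ⊈⇒∃ B∪A⊈H
    ...   | y , y∈B∪A , y∉H =
      trans (r′-⊈H B∪A⊆E B∪A⊈H)
            (trans (r-spanning B∪A⊆E A⊆H (q⊆p∪q B A) y∈B∪A y∉H (≤-reflexive (sym 1+a≡k)))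
                   (trans (sym 1+a≡k) (cong suc (sym (r′-corank1 A⊆H 1+a≡k)))))
      where
      B∪A⊆E : B ∪ A ⊆ E M
      B∪A⊆E = ∪-⊆ (⊆-trans B⊆ (⊆-trans (p─q⊆p _ A) (subst (_ ⊆_) E′≡E ⊆-refl))) A⊆E

  module _ (i : ℕ) where
    private
      coeff : Subset n → ℕ → ℤ
      coeff B c = if c ≡ᵇ i then sign ∣ B ∣ else + 0

      H-part : Subset n → ℤ
      H-part B = if subᵇ B H then χ-relax-term k i ∣ B ∣ else + 0

    -- only subsets B of H with k ≤ ∣ B ∣ change rank, from k − 1 to k
    charTerm-relax : ∀ {B} → B ⊆ E M → coeff B (k ∸ r M′ B) ≡ coeff B (k ∸ r M B) + H-part B
    charTerm-relax {B} B⊆E with B ⊆? H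
    ... | no B⊈H = begin
      coeff B (k ∸ r M′ B)            ≡⟨ cong (λ c → coeff B (k ∸ c)) (r′-⊈H B⊆E B⊈H) ⟩
      coeff B (k ∸ r M B)             ≡⟨ ℤ.+-identityʳ _ ⟨
      coeff B (k ∸ r M B) + + 0       ≡⟨ cong (_+_ (coeff B (k ∸ r M B))) (if-false (⊈⇒subᵇ B⊈H)) ⟨
      coeff B (k ∸ r M B) + H-part B  ∎
      where open ≡-Reasoning
    ... | yes B⊆H with k ≤? ∣ B ∣
    ...   | no k≰b = begin
      coeff B (k ∸ r M′ B)            ≡⟨ cong (λ c → coeff B (k ∸ c)) (r′-small B⊆E (≰⇒> k≰b)) ⟩
      coeff B (k ∸ r M B)             ≡⟨ ℤ.+-identityʳ _ ⟨
      coeff B (k ∸ r M B) + + 0       ≡⟨ cong (_+_ (coeff B (k ∸ r M B)))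
                                              (trans (if-true (⊆⇒subᵇ B⊆H)) (if-false (≰⇒≤ᵇ≡false k≰b))) ⟨
      coeff B (k ∸ r M B) + H-part B  ∎
      where open ≡-Reasoning
    ...   | yes k≤b = begin
      coeff B (k ∸ r M′ B)                         ≡⟨ cong (λ c → coeff B (k ∸ c)) (r′-large B⊆H k≤b) ⟩
      coeff B (k ∸ k)                              ≡⟨ cong (coeff B) (n∸n≡0 k) ⟩
      coeff B 0                                    ≡⟨ solve 2 (λ a b → a := b :+ (a :- b)) refl (coeff B 0) (coeff B 1) ⟩
      coeff B 1 + (coeff B 0 - coeff B 1)          ≡⟨ cong₂ _+_ (cong (coeff B) (sym k∸r≡1))
                                                           (sym (trans (if-true (⊆⇒subᵇ B⊆H)) (if-true (≤⇒≤ᵇ≡true k≤b)))) ⟩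
      coeff B (k ∸ r M B) + H-part B               ∎
      where
      open ≡-Reasoning
      open +-*-Solver using (solve; _:=_; _:+_; _:-_)
      k∸r≡1 : k ∸ r M B ≡ 1
      k∸r≡1 = trans (cong (k ∸_) (trans (r-⊆H B⊆H) (≤1+⇒⊓[∸1]≡ (m≤n⇒m≤1+n k≤b)))) (m∸[m∸n]≡n k-pos)

    charPoly′-E : charPoly (localize M′ (E M)) i ≡ charPoly (localize M (E M)) i + χ-relax-defect k ∣ H ∣ i
    charPoly′-E = begin
      charPoly (localize M′ (E M)) i
        ≡⟨ charPoly-expand (localize M′ (E M)) i ⟩
      Σₛ (charTerm (localize M′ (E M)) i)
        ≡⟨ Σₛ-cong term ⟩
      Σₛ (λ B → charTerm (localize M (E M)) i B + H-part B)
        ≡⟨ Σₛ-+ (charTerm (localize M (E M)) i) H-part ⟩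
      Σₛ (charTerm (localize M (E M)) i) + Σₛ H-part
        ≡⟨ cong₂ _+_ (sym (charPoly-expand (localize M (E M)) i)) (Σₛ-⊆-by-size H (χ-relax-term k i)) ⟩
      charPoly (localize M (E M)) i + χ-relax-defect k ∣ H ∣ i ∎
      where
      open ≡-Reasoning
      term : ∀ B → charTerm (localize M′ (E M)) i B ≡ charTerm (localize M (E M)) i B + H-part B
      term B with B ⊆? E M
      ... | no B⊈E = trans (if-false (⊈⇒subᵇ B⊈E))
                           (sym (cong₂ _+_ (if-false (⊈⇒subᵇ B⊈E)) (if-false (⊈⇒subᵇ {B = H} λ B⊆H → B⊈E (⊆-trans B⊆H H⊆E)))))
      ... | yes B⊆E = begin
        charTerm (localize M′ (E M)) i B              ≡⟨ if-true (⊆⇒subᵇ B⊆E) ⟩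
        coeff B (r M′ (E M) ∸ r M′ B)                 ≡⟨ cong (λ c → coeff B (c ∸ r M′ B)) r′-E ⟩
        coeff B (k ∸ r M′ B)                          ≡⟨ charTerm-relax B⊆E ⟩
        coeff B (k ∸ r M B) + H-part B                ≡⟨ cong (λ c → coeff B (c ∸ r M B) + H-part B) rank≡k ⟨
        coeff B (r M (E M) ∸ r M B) + H-part B        ≡⟨ cong (_+ H-part B) (if-true (⊆⇒subᵇ B⊆E)) ⟨
        charTerm (localize M (E M)) i B + H-part B    ∎

  contract-relaxation : ∀ {A} → A ⊆ H → (2+j≤k : 2 +ℕ ∣ A ∣ ≤ k) →
    Relaxation (contract M A) (k ∸ ∣ A ∣) (H ─ A) (contract M′ A)
  contract-relaxation {A} A⊆H 2+j≤k = record
    { E′≡E = cong (_─ A) E′≡E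
    ; r′-large = λ {B} B⊆H─A k-j≤b → cong₂ _∸_ (r′-large (∪A-⊆H A⊆H 2+j≤k B⊆H─A) (large B⊆H─A k-j≤b)) r′-A
    ; r′-⊈H = λ {B} B⊆E─A B⊈H─A → cong₂ _∸_ (r′-⊈H (∪A-⊆E A⊆H 2+j≤k B⊆E─A) (∪A-⊈H B⊆E─A B⊈H─A))
                                             (r′-small A⊆E j<k)
    ; r′-small = λ {B} B⊆E─A b<k-j → cong₂ _∸_ (r′-small (∪A-⊆E A⊆H 2+j≤k B⊆E─A) (small B⊆E─A b<k-j))
                                               (r′-small A⊆E j<k)
    }
    where
    open ≤-Reasoning
    j : ℕ
    j = ∣ A ∣
    A⊆E : A ⊆ E M
    A⊆E = ⊆-trans A⊆H H⊆E
    j<k : j < k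
    j<k = ≤-trans (n≤1+n _) 2+j≤k
    r′-A : r M′ A ≡ j
    r′-A = trans (r′-small A⊆E j<k) (r-small A⊆H 2+j≤k)
    large : ∀ {B} → B ⊆ H ─ A → k ∸ j ≤ ∣ B ∣ → k ≤ ∣ B ∪ A ∣
    large {B} B⊆H─A k-j≤b = begin
      k                  ≡⟨ m∸n+n≡m (<⇒≤ j<k) ⟨
      (k ∸ j) +ℕ j       ≤⟨ +-monoˡ-≤ j k-j≤b ⟩
      ∣ B ∣ +ℕ j         ≡⟨ ∣∪A∣ A⊆H 2+j≤k (⊆-trans B⊆H─A (H─A⊆E─A A⊆H 2+j≤k)) ⟨
      ∣ B ∪ A ∣          ∎
    small : ∀ {B} → B ⊆ E M ─ A → ∣ B ∣ < k ∸ j → ∣ B ∪ A ∣ < k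
    small {B} B⊆E─A b<k-j = begin-strict
      ∣ B ∪ A ∣          ≡⟨ ∣∪A∣ A⊆H 2+j≤k B⊆E─A ⟩
      ∣ B ∣ +ℕ j         <⟨ +-monoˡ-< j b<k-j ⟩
      (k ∸ j) +ℕ j       ≡⟨ m∸n+n≡m (<⇒≤ j<k) ⟩
      k                  ∎
    ∪A-⊈H : ∀ {B} → B ⊆ E M ─ A → B ⊈ H ─ A → B ∪ A ⊈ H
    ∪A-⊈H {B} B⊆E─A B⊈H─A B∪A⊆H with ⊈⇒∃ B⊈H─A
    ... | x , x∈B , x∉H─A = x∉H─A (x∈p∧x∉q⇒x∈p─q (B∪A⊆H (p⊆p∪q A x∈B)) (x∈p─q⇒x∉q (B⊆E─A x∈B)))

-- The Kazhdan–Lusztig polynomial of a relaxation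

mutual
  -- the change, under relaxation, of the term of a j-subset of H in the recursion for P
  KL-defect-term : ℕ → ℕ → ℕ → ℕ → Poly
  KL-defect-term f k h j i =
    (if (1 ≤ᵇ j) ∧ (2 +ℕ j ≤ᵇ k) then (uniformCharPoly k j *P KL-defect f (k ∸ j) (h ∸ j)) i
     else if (1 ≤ᵇ j) ∧ (suc j ≡ᵇ k) then uniformCharPoly k j i else + 0)
    + (if j ≡ᵇ h then - uniformCharPoly k h i else + 0)

  KL-defect : ℕ → ℕ → ℕ → Poly
  KL-defect zero k h i = + 0
  KL-defect (suc f) k h i =
    if 2 *ℕ i <ᵇ k
    then - (binomialSum h (λ j → KL-defect-term f k h j i) + χ-relax-defect k h i)
    else + 0

data Position (k j : ℕ) : Set where
  below : 2 +ℕ j ≤ k → Position k j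
  just-below : suc j ≡ k → Position k j
  at-or-above : k ≤ j → Position k j

position : ∀ k j → Position k j
position k j with 2 +ℕ j ≤? k | suc j ≟ k
... | yes 2+j≤k | _ = below 2+j≤k
... | no _ | yes 1+j≡k = just-below 1+j≡k
... | no 2+j≰k | no 1+j≢k = at-or-above (≤-pred (≤∧≢⇒< (≤-pred (≰⇒> 2+j≰k)) (1+j≢k ∘ sym)))

KLstep-pos : ∀ {k} (f : ℕ) (M : RMat n) (i : ℕ) → 0 < k →
  KLstep f M k i ≡ (if 2 *ℕ i <ᵇ k then - flatSum f M i else + 0)
KLstep-pos {k = suc k} f M i _ = refl

if-+-cancel : (b : Bool) (X Y : ℤ) → X ≡ (if b then Y else + 0) + (X + (if b then - Y else + 0))
if-+-cancel true X Y = +-*-Solver.solve 2 (λ X Y → X := Y :+ (X :+ (:- Y))) refl X Y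
  where open +-*-Solver using (_:=_; _:+_; :-_)
if-+-cancel false X Y = sym (trans (ℤ.+-identityˡ _) (ℤ.+-identityʳ X))

if-neg-+ : (b : Bool) (X Y : ℤ) →
  (if b then - (X + Y) else + 0) ≡ (if b then - X else + 0) + (if b then - Y else + 0)
if-neg-+ true X Y = ℤ.neg-distrib-+ X Y
if-neg-+ false X Y = refl

module _ (f k h i : ℕ) where

  KL-defect-term-0 : 0 < h → KL-defect-term f k h 0 i ≡ + 0
  KL-defect-term-0 h>0 = cong (_+_ (+ 0)) (if-false (≢⇒≡ᵇ≡false (<⇒≢ h>0)))

  KL-defect-term-below : ∀ {j} → 0 < j → 2 +ℕ j ≤ k → k ≤ suc h →
    KL-defect-term f k h j i ≡ (uniformCharPoly k j *P KL-defect f (k ∸ j) (h ∸ j)) i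
  KL-defect-term-below j>0 2+j≤k k≤1+h =
    trans (cong₂ _+_ (if-true (cong₂ _∧_ (≤⇒≤ᵇ≡true j>0) (≤⇒≤ᵇ≡true 2+j≤k)))
                     (if-false (≢⇒≡ᵇ≡false λ j≡h → <-irrefl refl (≤-trans 2+j≤k (subst (λ c → k ≤ suc c) (sym j≡h) k≤1+h)))))
          (ℤ.+-identityʳ _)

  KL-defect-term-just-below : ∀ {j} → 0 < j → suc j ≡ k →
    KL-defect-term f k h j i ≡ uniformCharPoly k j i + (if j ≡ᵇ h then - uniformCharPoly k h i else + 0)
  KL-defect-term-just-below {j} j>0 1+j≡k = cong (_+ (if j ≡ᵇ h then - uniformCharPoly k h i else + 0))
    (trans (if-false (cong₂ _∧_ (≤⇒≤ᵇ≡true j>0) (≰⇒≤ᵇ≡false λ 2+j≤k → <-irrefl 1+j≡k 2+j≤k)))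
           (if-true (cong₂ _∧_ (≤⇒≤ᵇ≡true j>0) (≡⇒≡ᵇ≡true 1+j≡k))))

  KL-defect-term-at-or-above : ∀ {j} → k ≤ j →
    KL-defect-term f k h j i ≡ + 0 + (if j ≡ᵇ h then - uniformCharPoly k h i else + 0)
  KL-defect-term-at-or-above {j} k≤j = cong (_+ (if j ≡ᵇ h then - uniformCharPoly k h i else + 0))
    (trans (if-false (trans (cong ((1 ≤ᵇ j) ∧_) (≰⇒≤ᵇ≡false 2+j≰k)) (∧-zeroʳ (1 ≤ᵇ j))))
           (if-false (trans (cong ((1 ≤ᵇ j) ∧_) (≢⇒≡ᵇ≡false 1+j≢k)) (∧-zeroʳ (1 ≤ᵇ j)))))
    where
    2+j≰k : 2 +ℕ j ≰ k
    2+j≰k 2+j≤k = <-irrefl refl (≤-trans (n≤1+n _) (≤-trans 2+j≤k k≤j))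
    1+j≢k : suc j ≢ k
    1+j≢k 1+j≡k = <⇒≱ (≤-reflexive 1+j≡k) k≤j

KLRelaxation : ℕ → Set
KLRelaxation f = ∀ {n} {M M′ : RMat n} {k H} → StressedHyperplane M k H → Relaxation M k H M′ → k ≤ f →
  ∀ fuel → ∣ E M ∣ < fuel → KLfuel fuel M′ ≗ (KLfuel fuel M +P KL-defect f k ∣ H ∣)

module RelaxedFlatSum (f : ℕ) (IH : KLRelaxation f) {M M′ : RMat n} {k : ℕ} {H : Subset n}
                      (S : StressedHyperplane M k H) (R : Relaxation M k H M′) (k≤1+f : k ≤ suc f)
                      (fuel : ℕ) (E≤1+fuel : ∣ E M ∣ ≤ suc fuel) (i : ℕ) where
  open StressedHyperplane S
  open StressedHyperplaneProperties S
  open Relaxation R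
  open RelaxationProperties S R

  private
    F : ℕ
    F = suc fuel
    h : ℕ
    h = ∣ H ∣

  ∣E─A∣≤fuel : ∀ {A} → A ⊆ E M → 0 < ∣ A ∣ → ∣ E M ─ A ∣ ≤ fuel
  ∣E─A∣≤fuel {A} A⊆E pos = ≤-pred (begin
    suc ∣ E M ─ A ∣          ≡⟨ +-comm 1 _ ⟩
    ∣ E M ─ A ∣ +ℕ 1         ≤⟨ +-monoʳ-≤ ∣ E M ─ A ∣ pos ⟩
    ∣ E M ─ A ∣ +ℕ ∣ A ∣     ≡⟨ ∣─∣+∣∣≡ A⊆E ⟩
    ∣ E M ∣                  ≤⟨ E≤1+fuel ⟩
    suc fuel                 ∎)
    where open ≤-Reasoning

  flatTerm-⊆H-large : ∀ {A} → A ⊆ H → k ≤ suc ∣ A ∣ →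
    flatTerm F M A i ≡ (if ∣ A ∣ ≡ᵇ h then uniformCharPoly k h i else + 0)
  flatTerm-⊆H-large {A} A⊆H k≤ with ∣ A ∣ ≟ h
  ... | no a≢h = trans (flatTerm-nonflat F M A (isFlat-large A⊆H k≤ a≢h) i) (sym (if-false (≢⇒≡ᵇ≡false a≢h)))
  ... | yes a≡h with ∣∣>0⇒∃ H-nonempty
  ...   | x , x∈H = begin
    flatTerm F M A i                          ≡⟨ cong (λ S → flatTerm F M S i) (⊆∧∣≥∣⇒≡ A⊆H (≤-reflexive (sym a≡h))) ⟩
    flatTerm F M H i                          ≡⟨ flatTerm-flat F IsFlat-H x∈H i ⟩
    (χ-H *P KLfuel F (contract M H)) i
      ≡⟨ *P-congʳ χ-H (KLfuel-contract-H fuel (∣E─A∣≤fuel H⊆E H-nonempty)) i ⟩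
    (χ-H *P 1P) i                             ≡⟨ *P-identityʳ χ-H i ⟩
    χ-H i                                     ≡⟨ charPoly-localize-⊆H ⊆-refl i ⟩
    uniformCharPoly k h i                     ≡⟨ if-true (≡⇒≡ᵇ≡true a≡h) ⟨
    (if ∣ A ∣ ≡ᵇ h then uniformCharPoly k h i else + 0) ∎
    where
    open ≡-Reasoning
    χ-H : Poly
    χ-H = charPoly (localize M H)

  flatTerm-relax-below : ∀ {A} → A ⊆ H → 0 < ∣ A ∣ → (2+a≤k : 2 +ℕ ∣ A ∣ ≤ k) →
    flatTerm F M′ A i ≡ flatTerm F M A i + (uniformCharPoly k ∣ A ∣ *P KL-defect f (k ∸ ∣ A ∣) (h ∸ ∣ A ∣)) i
  flatTerm-relax-below {A} A⊆H a>0 2+a≤k with ∣∣>0⇒∃ a>0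
  ... | x , x∈A = begin
    flatTerm F M′ A i                                   ≡⟨ flatTerm-flat F flat′ x∈A i ⟩
    (charPoly (localize M′ A) *P KLfuel F (contract M′ A)) i
      ≡⟨ *P-congˡ (KLfuel F (contract M′ A)) (charPoly′-localize-⊆H A⊆H a<k) i ⟩
    (χᵤ *P KLfuel F (contract M′ A)) i                  ≡⟨ *P-congʳ χᵤ IH-A i ⟩
    (χᵤ *P (KLfuel F (contract M A) +P Δ)) i            ≡⟨ *P-distribˡ-+P χᵤ (KLfuel F (contract M A)) Δ i ⟩
    (χᵤ *P KLfuel F (contract M A)) i + (χᵤ *P Δ) i
      ≡⟨ cong (_+ (χᵤ *P Δ) i) (*P-congˡ (KLfuel F (contract M A)) (charPoly-localize-⊆H A⊆H) i) ⟨
    (charPoly (localize M A) *P KLfuel F (contract M A)) i + (χᵤ *P Δ) i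
      ≡⟨ cong (_+ (χᵤ *P Δ) i) (flatTerm-flat F flat x∈A i) ⟨
    flatTerm F M A i + (χᵤ *P Δ) i                      ∎
    where
    open ≡-Reasoning
    a<k : ∣ A ∣ < k
    a<k = ≤-trans (n≤1+n _) 2+a≤k
    χᵤ : Poly
    χᵤ = uniformCharPoly k ∣ A ∣
    Δ : Poly
    Δ = KL-defect f (k ∸ ∣ A ∣) (h ∸ ∣ A ∣)
    flat : IsFlat M A
    flat = IsFlat-small A⊆H 2+a≤k
    flat′ : IsFlat M′ A
    flat′ = IsFlat′-small 2+a≤k flat
    IH-A : KLfuel F (contract M′ A) ≗ (KLfuel F (contract M A) +P Δ)
    IH-A j = trans (IH (contract-stressed A⊆H 2+a≤k) (contract-relaxation A⊆H 2+a≤k)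
                       (≤-trans (∸-monoʳ-≤ k a>0) (∸-monoˡ-≤ 1 k≤1+f)) F
                       (s≤s (∣E─A∣≤fuel (⊆-trans A⊆H H⊆E) a>0)) j)
                   (cong (λ c → KLfuel F (contract M A) j + KL-defect f (k ∸ ∣ A ∣) c j) (∣H─A∣≡ A⊆H 2+a≤k))

  flatTerm′-just-below : ∀ {A} → A ⊆ H → 0 < ∣ A ∣ → suc ∣ A ∣ ≡ k →
    flatTerm F M′ A i ≡ uniformCharPoly k ∣ A ∣ i
  flatTerm′-just-below {A} A⊆H a>0 1+a≡k with ∣∣>0⇒∃ a>0
  ... | x , x∈A = begin
    flatTerm F M′ A i                                   ≡⟨ flatTerm-flat F (IsFlat′-corank1 A⊆H 1+a≡k) x∈A i ⟩
    (χ′ *P KLfuel F (contract M′ A)) i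
      ≡⟨ *P-congʳ χ′ (KLfuel′-contract-corank1 fuel A⊆H 1+a≡k (∣E─A∣≤fuel (⊆-trans A⊆H H⊆E) a>0)) i ⟩
    (χ′ *P 1P) i                                        ≡⟨ *P-identityʳ χ′ i ⟩
    χ′ i                                                ≡⟨ charPoly′-localize-⊆H A⊆H (≤-reflexive 1+a≡k) i ⟩
    uniformCharPoly k ∣ A ∣ i                           ∎
    where
    open ≡-Reasoning
    χ′ : Poly
    χ′ = charPoly (localize M′ A)

  flatTerm-relax-⊆H : ∀ {A} → A ⊆ H → flatTerm F M′ A i ≡ flatTerm F M A i + KL-defect-term f k h ∣ A ∣ i
  flatTerm-relax-⊆H {A} A⊆H with 0 <? ∣ A ∣
  ... | no a≯0 = trans (flatTerm-empty F M′ A (nonemptyᵇ-empty empty) i)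
    (sym (cong₂ _+_ (flatTerm-empty F M A (nonemptyᵇ-empty empty) i)
                    (trans (cong (λ j → KL-defect-term f k h j i) (n≤0⇒n≡0 (≮⇒≥ a≯0)))
                           (KL-defect-term-0 f k h i H-nonempty))))
    where
    empty : ∀ {x} → x ∉ A
    empty = a≯0 ∘ ∈⇒∣∣>0
  ... | yes a>0 with position k ∣ A ∣
  ...   | below 2+a≤k = trans (flatTerm-relax-below A⊆H a>0 2+a≤k)
    (cong (_+_ (flatTerm F M A i)) (sym (KL-defect-term-below f k h i a>0 2+a≤k k≤1+∣H∣)))
  ...   | just-below 1+a≡k = trans (trans (flatTerm′-just-below A⊆H a>0 1+a≡k) (if-+-cancel (∣ A ∣ ≡ᵇ h) _ _))
    (cong₂ _+_ (sym (flatTerm-⊆H-large A⊆H (≤-reflexive (sym 1+a≡k)))) (sym (KL-defect-term-just-below f k h i a>0 1+a≡k)))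
  ...   | at-or-above k≤a = trans (trans (flatTerm-nonflat F M′ A (isFlat′-large A⊆H k≤a) i) (if-+-cancel (∣ A ∣ ≡ᵇ h) _ _))
    (cong₂ _+_ (sym (flatTerm-⊆H-large A⊆H (m≤n⇒m≤1+n k≤a))) (sym (KL-defect-term-at-or-above f k h i k≤a)))

  top : Subset n → ℤ
  top A = if subᵇ A (E M) then (if ∣ A ∣ ≡ᵇ ∣ E M ∣ then χ-relax-defect k h i else + 0) else + 0

  top-≢E : ∀ {A} → A ≢ E M → top A ≡ + 0
  top-≢E {A} A≢E with A ⊆? E M
  ... | no A⊈E = if-false (⊈⇒subᵇ A⊈E)
  ... | yes A⊆E = trans (if-true (⊆⇒subᵇ A⊆E)) (if-false (≢⇒≡ᵇ≡false λ a≡e → A≢E (⊆∧∣≥∣⇒≡ A⊆E (≤-reflexive (sym a≡e)))))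

  flatTerm-relax-E : flatTerm F M′ (E M) i ≡ flatTerm F M (E M) i + χ-relax-defect k h i
  flatTerm-relax-E with ∃-outside
  ... | x , x∈E , x∉H = begin
    flatTerm F M′ (E M) i                                      ≡⟨ flatTerm-flat F flat′ x∈E i ⟩
    (χ′ *P KLfuel F (contract M′ (E M))) i
      ≡⟨ *P-congʳ χ′ (subst (λ S → KLfuel F (contract M′ S) ≗ 1P) E′≡E (KLfuel-contract-E fuel M′)) i ⟩
    (χ′ *P 1P) i                                               ≡⟨ *P-identityʳ χ′ i ⟩
    χ′ i                                                       ≡⟨ charPoly′-E i ⟩
    χ i + χ-relax-defect k h i
      ≡⟨ cong (_+ χ-relax-defect k h i) (*P-identityʳ χ i) ⟨
    (χ *P 1P) i + χ-relax-defect k h i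
      ≡⟨ cong (_+ χ-relax-defect k h i) (*P-congʳ χ (KLfuel-contract-E fuel M) i) ⟨
    (χ *P KLfuel F (contract M (E M))) i + χ-relax-defect k h i
      ≡⟨ cong (_+ χ-relax-defect k h i) (flatTerm-flat F (IsFlat-E M) x∈E i) ⟨
    flatTerm F M (E M) i + χ-relax-defect k h i                ∎
    where
    open ≡-Reasoning
    χ′ : Poly
    χ′ = charPoly (localize M′ (E M))
    χ : Poly
    χ = charPoly (localize M (E M))
    flat′ : IsFlat M′ (E M)
    flat′ = IsFlat′-⊈H E⊈H (IsFlat-E M)

  top-E : top (E M) ≡ χ-relax-defect k h i
  top-E = trans (if-true (⊆⇒subᵇ {A = E M} ⊆-refl)) (if-true (≡⇒≡ᵇ≡true {m = ∣ E M ∣} refl))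

  flatTerm-relax-⊈H : ∀ {A} → A ⊈ H → flatTerm F M′ A i ≡ flatTerm F M A i + top A
  flatTerm-relax-⊈H {A} A⊈H with IsFlat? M A
  ... | no ¬flat = begin
    flatTerm F M′ A i         ≡⟨ flatTerm-nonflat F M′ A (trans (isFlat′-⊈H A⊈H) (¬IsFlat⇒isFlat≡false ¬flat)) i ⟩
    + 0                       ≡⟨ cong₂ _+_ (flatTerm-nonflat F M A (¬IsFlat⇒isFlat≡false ¬flat) i)
                                           (top-≢E λ A≡E → ¬flat (subst (IsFlat M) (sym A≡E) (IsFlat-E M))) ⟨
    flatTerm F M A i + top A  ∎
    where open ≡-Reasoning
  ... | yes flat with ∣ A ∣ ≟ ∣ E M ∣
  ...   | yes a≡e with ⊆∧∣≥∣⇒≡ (IsFlat.⊆E flat) (≤-reflexive (sym a≡e))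
  ...     | refl = trans flatTerm-relax-E (cong (_+_ (flatTerm F M (E M) i)) (sym top-E))
  flatTerm-relax-⊈H {A} A⊈H | yes flat | no a≢e with ⊈⇒∃ A⊈H
  ... | x , x∈A , _ = begin
    flatTerm F M′ A i                                         ≡⟨ flatTerm-flat F flat′ x∈A i ⟩
    (charPoly (localize M′ A) *P KLfuel F (contract M′ A)) i
      ≡⟨ *P-congˡ (KLfuel F (contract M′ A)) (charPoly-cong (localize′-flat-⊈H flat A⊈H a<e)) i ⟩
    (charPoly (localize M A) *P KLfuel F (contract M′ A)) i
      ≡⟨ *P-congʳ (charPoly (localize M A)) (KLfuel-cong F (contract′-⊈H (IsFlat.⊆E flat) A⊈H)) i ⟩
    (charPoly (localize M A) *P KLfuel F (contract M A)) i    ≡⟨ flatTerm-flat F flat x∈A i ⟨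
    flatTerm F M A i                                          ≡⟨ ℤ.+-identityʳ _ ⟨
    flatTerm F M A i + + 0
      ≡⟨ cong (_+_ (flatTerm F M A i)) (top-≢E {A} (a≢e ∘ cong ∣_∣)) ⟨
    flatTerm F M A i + top A                                  ∎
    where
    open ≡-Reasoning
    flat′ : IsFlat M′ A
    flat′ = IsFlat′-⊈H A⊈H flat
    a<e : ∣ A ∣ < ∣ E M ∣
    a<e = ≤∧≢⇒< (p⊆q⇒∣p∣≤∣q∣ (IsFlat.⊆E flat)) a≢e

  flatSum-relax : flatSum F M′ i ≡
    flatSum F M i + (binomialSum h (λ j → KL-defect-term f k h j i) + χ-relax-defect k h i)
  flatSum-relax = begin
    flatSum F M′ i
      ≡⟨ flatSum-expand F M′ i ⟩
    Σₛ (λ A → flatTerm F M′ A i)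
      ≡⟨ Σₛ-cong term ⟩
    Σₛ (λ A → flatTerm F M A i + (H-part A + top A))
      ≡⟨ Σₛ-+ (λ A → flatTerm F M A i) (λ A → H-part A + top A) ⟩
    Σₛ (λ A → flatTerm F M A i) + Σₛ (λ A → H-part A + top A)
      ≡⟨ cong₂ _+_ (sym (flatSum-expand F M i)) (Σₛ-+ H-part top) ⟩
    flatSum F M i + (Σₛ H-part + Σₛ top)
      ≡⟨ cong (λ z → flatSum F M i + z)
              (cong₂ _+_ (Σₛ-⊆-by-size H (λ j → KL-defect-term f k h j i))
                         (trans (Σₛ-⊆-by-size (E M) _) (binomialSum-top ∣ E M ∣ (χ-relax-defect k h i)))) ⟩
    flatSum F M i + (binomialSum h (λ j → KL-defect-term f k h j i) + χ-relax-defect k h i) ∎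
    where
    open ≡-Reasoning
    H-part : Subset n → ℤ
    H-part A = if subᵇ A H then KL-defect-term f k h ∣ A ∣ i else + 0
    term : ∀ A → flatTerm F M′ A i ≡ flatTerm F M A i + (H-part A + top A)
    term A with A ⊆? H
    ... | yes A⊆H = trans (flatTerm-relax-⊆H A⊆H) (cong (_+_ (flatTerm F M A i)) (sym (begin
      H-part A + top A                         ≡⟨ cong₂ _+_ (if-true (⊆⇒subᵇ A⊆H))
                                                            (top-≢E λ A≡E → E⊈H (subst (_⊆ H) A≡E A⊆H)) ⟩
      KL-defect-term f k h (∣ A ∣) i + + 0     ≡⟨ ℤ.+-identityʳ _ ⟩
      KL-defect-term f k h (∣ A ∣) i           ∎)))
    ... | no A⊈H = trans (flatTerm-relax-⊈H A⊈H)
      (cong (_+_ (flatTerm F M A i)) (sym (trans (cong (_+ top A) (if-false (⊈⇒subᵇ A⊈H))) (ℤ.+-identityˡ (top A)))))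

KL-relax : ∀ f → KLRelaxation f
KL-relax zero S _ k≤0 = contradiction k≤0 (<⇒≱ (StressedHyperplane.k-pos S))
KL-relax (suc f) S R k≤1+f zero ()
KL-relax (suc f) S R k≤1+f (suc zero) (s≤s E≤0) =
  contradiction E≤0 (<⇒≱ (≤-trans H-nonempty (p⊆q⇒∣p∣≤∣q∣ H⊆E)))
  where open StressedHyperplane S
KL-relax (suc f) {M = M} {M′} {k} {H} S R k≤1+f (suc (suc fuel)) (s≤s E≤1+fuel) i = begin
  KLfuel (suc F) M′ i                                            ≡⟨ KLfuel-unfold F M′ i ⟩
  KLstep F M′ (rank M′) i                                        ≡⟨ cong (λ c → KLstep F M′ c i) rank′≡k ⟩
  KLstep F M′ k i                                                ≡⟨ KLstep-pos F M′ i k-pos ⟩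
  (if b then - flatSum F M′ i else + 0)                          ≡⟨ cong (λ s → if b then - s else + 0) flatSum-relax ⟩
  (if b then - (flatSum F M i + Δ) else + 0)                     ≡⟨ if-neg-+ b (flatSum F M i) Δ ⟩
  (if b then - flatSum F M i else + 0) + KL-defect (suc f) k h i
    ≡⟨ cong (_+ KL-defect (suc f) k h i) (KLstep-pos F M i k-pos) ⟨
  KLstep F M k i + KL-defect (suc f) k h i
    ≡⟨ cong (λ c → KLstep F M c i + KL-defect (suc f) k h i) rank≡k ⟨
  KLstep F M (rank M) i + KL-defect (suc f) k h i
    ≡⟨ cong (_+ KL-defect (suc f) k h i) (KLfuel-unfold F M i) ⟨
  KLfuel (suc F) M i + KL-defect (suc f) k h i               ∎
  where
  open ≡-Reasoning
  open StressedHyperplane S using (k-pos; rank≡k)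
  open RelaxationProperties S R using (rank′≡k)
  open RelaxedFlatSum f (KL-relax f) S R k≤1+f fuel E≤1+fuel i using (flatSum-relax)
  F : ℕ
  F = suc fuel
  b : Bool
  b = 2 *ℕ i <ᵇ k
  h : ℕ
  h = ∣ H ∣
  Δ : ℤ
  Δ = binomialSum h (λ j → KL-defect-term f k h j i) + χ-relax-defect k h i

-- The Z-polynomial of a relaxation

-- the change, under relaxation, of the term of a j-subset of H in Z
Z-defect-term : ℕ → ℕ → ℕ → ℕ → ℤ
Z-defect-term k h j m =
  (if 2 +ℕ j ≤ᵇ k then shiftP j (KL-defect k (k ∸ j) (h ∸ j)) m
   else if suc j ≡ᵇ k then shiftP j 1P m else + 0)
  + (if j ≡ᵇ h then - shiftP (k ∸ 1) 1P m else + 0)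

Z-defect : ℕ → ℕ → Poly
Z-defect k h m = binomialSum h (λ j → Z-defect-term k h j m)

module _ (k h m : ℕ) where

  Z-defect-term-below : ∀ {j} → 2 +ℕ j ≤ k → k ≤ suc h →
    Z-defect-term k h j m ≡ shiftP j (KL-defect k (k ∸ j) (h ∸ j)) m
  Z-defect-term-below 2+j≤k k≤1+h =
    trans (cong₂ _+_ (if-true (≤⇒≤ᵇ≡true 2+j≤k))
                     (if-false (≢⇒≡ᵇ≡false λ j≡h → <-irrefl refl (≤-trans 2+j≤k (subst (λ c → k ≤ suc c) (sym j≡h) k≤1+h)))))
          (ℤ.+-identityʳ _)

  Z-defect-term-just-below : ∀ {j} → suc j ≡ k →
    Z-defect-term k h j m ≡ shiftP j 1P m + (if j ≡ᵇ h then - shiftP (k ∸ 1) 1P m else + 0)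
  Z-defect-term-just-below {j} 1+j≡k = cong (_+ (if j ≡ᵇ h then - shiftP (k ∸ 1) 1P m else + 0))
    (trans (if-false (≰⇒≤ᵇ≡false λ 2+j≤k → <-irrefl 1+j≡k 2+j≤k)) (if-true (≡⇒≡ᵇ≡true 1+j≡k)))

  Z-defect-term-at-or-above : ∀ {j} → k ≤ j →
    Z-defect-term k h j m ≡ + 0 + (if j ≡ᵇ h then - shiftP (k ∸ 1) 1P m else + 0)
  Z-defect-term-at-or-above {j} k≤j = cong (_+ (if j ≡ᵇ h then - shiftP (k ∸ 1) 1P m else + 0))
    (trans (if-false (≰⇒≤ᵇ≡false λ 2+j≤k → <-irrefl refl (≤-trans (n≤1+n _) (≤-trans 2+j≤k k≤j))))
           (if-false (≢⇒≡ᵇ≡false λ 1+j≡k → <⇒≱ (≤-reflexive 1+j≡k) k≤j)))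

module RelaxedZ {M M′ : RMat n} {k : ℕ} {H : Subset n}
                (S : StressedHyperplane M k H) (R : Relaxation M k H M′) (m : ℕ) where
  open StressedHyperplane S
  open StressedHyperplaneProperties S
  open Relaxation R
  open RelaxationProperties S R

  private
    h : ℕ
    h = ∣ H ∣

  Zterm-⊆H-large : ∀ {A} → A ⊆ H → k ≤ suc ∣ A ∣ →
    Zterm M A m ≡ (if ∣ A ∣ ≡ᵇ h then shiftP (k ∸ 1) 1P m else + 0)
  Zterm-⊆H-large {A} A⊆H k≤ with ∣ A ∣ ≟ h
  ... | no a≢h = trans (Zterm-nonflat M A (isFlat-large A⊆H k≤ a≢h) m) (sym (if-false (≢⇒≡ᵇ≡false a≢h)))
  ... | yes a≡h = begin
    Zterm M A m                                        ≡⟨ cong (λ S → Zterm M S m) (⊆∧∣≥∣⇒≡ A⊆H (≤-reflexive (sym a≡h))) ⟩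
    Zterm M H m                                        ≡⟨ Zterm-flat IsFlat-H m ⟩
    shiftP (r M H) (KL (contract M H)) m               ≡⟨ cong (λ d → shiftP d (KL (contract M H)) m) r-H ⟩
    shiftP (k ∸ 1) (KL (contract M H)) m               ≡⟨ shiftP-cong (k ∸ 1) (KLfuel-contract-H n (∣p∣≤n (E M ─ H))) m ⟩
    shiftP (k ∸ 1) 1P m                                ≡⟨ if-true (≡⇒≡ᵇ≡true a≡h) ⟨
    (if ∣ A ∣ ≡ᵇ h then shiftP (k ∸ 1) 1P m else + 0)  ∎
    where open ≡-Reasoning

  Zterm-relax-below : ∀ {A} → A ⊆ H → (2+a≤k : 2 +ℕ ∣ A ∣ ≤ k) →
    Zterm M′ A m ≡ Zterm M A m + shiftP ∣ A ∣ (KL-defect k (k ∸ ∣ A ∣) (h ∸ ∣ A ∣)) m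
  Zterm-relax-below {A} A⊆H 2+a≤k = begin
    Zterm M′ A m                                          ≡⟨ Zterm-flat flat′ m ⟩
    shiftP (r M′ A) (KL (contract M′ A)) m                ≡⟨ cong (λ d → shiftP d (KL (contract M′ A)) m) r′-A ⟩
    shiftP a (KL (contract M′ A)) m                       ≡⟨ shiftP-cong a KL-A m ⟩
    shiftP a (KL (contract M A) +P Δ) m                   ≡⟨ shiftP-+P a (KL (contract M A)) Δ m ⟩
    shiftP a (KL (contract M A)) m + shiftP a Δ m
      ≡⟨ cong (λ d → shiftP d (KL (contract M A)) m + shiftP a Δ m) (r-small A⊆H 2+a≤k) ⟨
    shiftP (r M A) (KL (contract M A)) m + shiftP a Δ m   ≡⟨ cong (_+ shiftP a Δ m) (Zterm-flat flat m) ⟨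
    Zterm M A m + shiftP a Δ m                            ∎
    where
    open ≡-Reasoning
    a : ℕ
    a = ∣ A ∣
    Δ : Poly
    Δ = KL-defect k (k ∸ a) (h ∸ a)
    flat : IsFlat M A
    flat = IsFlat-small A⊆H 2+a≤k
    flat′ : IsFlat M′ A
    flat′ = IsFlat′-small 2+a≤k flat
    r′-A : r M′ A ≡ a
    r′-A = trans (r′-small (⊆-trans A⊆H H⊆E) (≤-trans (n≤1+n _) 2+a≤k)) (r-small A⊆H 2+a≤k)
    KL-A : KL (contract M′ A) ≗ (KL (contract M A) +P Δ)
    KL-A j = trans (KL-relax k (contract-stressed A⊆H 2+a≤k) (contract-relaxation A⊆H 2+a≤k)
                            (m∸n≤m k a) (suc n) (s≤s (∣p∣≤n (E M ─ A))) j)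
                   (cong (λ c → KL (contract M A) j + KL-defect k (k ∸ a) c j) (∣H─A∣≡ A⊆H 2+a≤k))

  Zterm′-just-below : ∀ {A} → A ⊆ H → suc ∣ A ∣ ≡ k → Zterm M′ A m ≡ shiftP ∣ A ∣ 1P m
  Zterm′-just-below {A} A⊆H 1+a≡k = begin
    Zterm M′ A m                                ≡⟨ Zterm-flat (IsFlat′-corank1 A⊆H 1+a≡k) m ⟩
    shiftP (r M′ A) (KL (contract M′ A)) m      ≡⟨ cong (λ d → shiftP d (KL (contract M′ A)) m) (r′-corank1 A⊆H 1+a≡k) ⟩
    shiftP (∣ A ∣) (KL (contract M′ A)) m       ≡⟨ shiftP-cong (∣ A ∣) (KLfuel′-contract-corank1 n A⊆H 1+a≡k (∣p∣≤n (E M ─ A))) m ⟩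
    shiftP (∣ A ∣) 1P m                         ∎
    where open ≡-Reasoning

  Zterm-relax-⊆H : ∀ {A} → A ⊆ H → Zterm M′ A m ≡ Zterm M A m + Z-defect-term k h ∣ A ∣ m
  Zterm-relax-⊆H {A} A⊆H with position k ∣ A ∣
  ... | below 2+a≤k = trans (Zterm-relax-below A⊆H 2+a≤k)
    (cong (_+_ (Zterm M A m)) (sym (Z-defect-term-below k h m 2+a≤k k≤1+∣H∣)))
  ... | just-below 1+a≡k = trans (trans (Zterm′-just-below A⊆H 1+a≡k) (if-+-cancel (∣ A ∣ ≡ᵇ h) _ _))
    (cong₂ _+_ (sym (Zterm-⊆H-large A⊆H (≤-reflexive (sym 1+a≡k)))) (sym (Z-defect-term-just-below k h m 1+a≡k)))
  ... | at-or-above k≤a = trans (trans (Zterm-nonflat M′ A (isFlat′-large A⊆H k≤a) m) (if-+-cancel (∣ A ∣ ≡ᵇ h) _ _))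
    (cong₂ _+_ (sym (Zterm-⊆H-large A⊆H (m≤n⇒m≤1+n k≤a))) (sym (Z-defect-term-at-or-above k h m k≤a)))

  Zterm-relax-⊈H : ∀ {A} → A ⊈ H → Zterm M′ A m ≡ Zterm M A m
  Zterm-relax-⊈H {A} A⊈H with IsFlat? M A
  ... | no ¬flat = trans (Zterm-nonflat M′ A (trans (isFlat′-⊈H A⊈H) (¬IsFlat⇒isFlat≡false ¬flat)) m)
                         (sym (Zterm-nonflat M A (¬IsFlat⇒isFlat≡false ¬flat) m))
  ... | yes flat = begin
    Zterm M′ A m                              ≡⟨ Zterm-flat (IsFlat′-⊈H A⊈H flat) m ⟩
    shiftP (r M′ A) (KL (contract M′ A)) m    ≡⟨ cong (λ d → shiftP d (KL (contract M′ A)) m) (r′-⊈H A⊆E A⊈H) ⟩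
    shiftP (r M A) (KL (contract M′ A)) m     ≡⟨ shiftP-cong (r M A) (KLfuel-cong (suc n) (contract′-⊈H A⊆E A⊈H)) m ⟩
    shiftP (r M A) (KL (contract M A)) m      ≡⟨ Zterm-flat flat m ⟨
    Zterm M A m                               ∎
    where
    open ≡-Reasoning
    A⊆E : A ⊆ E M
    A⊆E = IsFlat.⊆E flat

  Zpoly-relax : Zpoly M′ m ≡ Zpoly M m + Z-defect k h m
  Zpoly-relax = begin
    Zpoly M′ m                                    ≡⟨ Zpoly-expand M′ m ⟩
    Σₛ (λ A → Zterm M′ A m)                       ≡⟨ Σₛ-cong term ⟩
    Σₛ (λ A → Zterm M A m + H-part A)             ≡⟨ Σₛ-+ (λ A → Zterm M A m) H-part ⟩
    Σₛ (λ A → Zterm M A m) + Σₛ H-part            ≡⟨ cong₂ _+_ (sym (Zpoly-expand M m)) (Σₛ-⊆-by-size H (λ j → Z-defect-term k h j m)) ⟩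
    Zpoly M m + Z-defect k h m                    ∎
    where
    open ≡-Reasoning
    H-part : Subset n → ℤ
    H-part A = if subᵇ A H then Z-defect-term k h ∣ A ∣ m else + 0
    term : ∀ A → Zterm M′ A m ≡ Zterm M A m + H-part A
    term A with A ⊆? H
    ... | yes A⊆H = trans (Zterm-relax-⊆H A⊆H) (cong (_+_ (Zterm M A m)) (sym (if-true (⊆⇒subᵇ A⊆H))))
    ... | no A⊈H = trans (Zterm-relax-⊈H A⊈H)
      (sym (trans (cong (_+_ (Zterm M A m)) (if-false (⊈⇒subᵇ A⊈H))) (ℤ.+-identityʳ _)))

-- γ-polynomials

-- the coefficient of t^m in t^i (1+t)^(k-2i)
γcoeff : ℕ → ℕ → ℕ → ℤ
γcoeff k i m = if i ≤ᵇ m then + ((k ∸ 2 *ℕ i) choose (m ∸ i)) else + 0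

-- solve the coefficient of t^m of Z(t) = Σ γᵢ tⁱ (1+t)^(k-2i) for γₘ, given γᵢ = p i for i < m
γ-solve-step : ℕ → Poly → ℕ → Poly → ℤ
γ-solve-step k Z m p =
  if k <ᵇ 2 *ℕ m then + 0 else Z m - sumℤ (map (λ i → p i * γcoeff k i m) (upTo m))

-- the values of γ-solve below m, tabulated so that γ-solve is structurally recursive
γ-table : ℕ → Poly → ℕ → Poly
γ-table k Z zero _ = + 0
γ-table k Z (suc m) i = if i <ᵇ m then γ-table k Z m i else γ-solve-step k Z m (γ-table k Z m)

γ-solve : ℕ → Poly → Poly
γ-solve k Z m = γ-solve-step k Z m (γ-table k Z m)

γ-table-lookup : ∀ k Z m {i} → i < m → γ-table k Z m i ≡ γ-solve k Z i
γ-table-lookup k Z (suc m) {i} i<1+m with i <? m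
... | yes i<m = trans (if-true (<⇒<ᵇ≡true i<m)) (γ-table-lookup k Z m i<m)
... | no i≮m with ≤-antisym (≤-pred i<1+m) (≮⇒≥ i≮m)
...   | refl = if-false (≮⇒<ᵇ≡false i≮m)

IsPoly-γ-solve : ∀ k Z → IsPoly (γ-solve k Z)
IsPoly-γ-solve k Z = k , λ i k<i → if-true (<⇒<ᵇ≡true (<-≤-trans k<i (m≤n*m i 2)))

sumℤ-upTo-≥ : (F : ℕ → ℤ) {m N : ℕ} → (∀ i → m ≤ i → F i ≡ + 0) → m ≤ N →
  sumℤ (map F (upTo N)) ≡ sumℤ (map F (upTo m))
sumℤ-upTo-≥ F {m} {zero} _ z≤n = refl
sumℤ-upTo-≥ F {m} {suc N} F≡0 m≤1+N with m ≤? N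
... | yes m≤N = trans (sumℤ-upTo-suc F N)
                      (trans (cong₂ _+_ (sumℤ-upTo-≥ F F≡0 m≤N) (F≡0 N m≤N)) (ℤ.+-identityʳ _))
... | no m≰N with ≤-antisym m≤1+N (≰⇒> m≰N)
...   | refl = refl

-- at t^m only the γᵢ with i ≤ m contribute, and γₘ with coefficient 1
IsGamma-coeff : ∀ {k Z γ} → IsGamma k Z γ → ∀ {m} → 2 *ℕ m ≤ k →
  Z m ≡ sumℤ (map (λ i → γ i * γcoeff k i m) (upTo m)) + γ m
IsGamma-coeff {k} {Z} {γ} (_ , Z-expand) {m} 2m≤k = begin
  Z m                                                    ≡⟨ Z-expand m ⟩
  sumℤ (map term (upTo (suc k)))                         ≡⟨ sumℤ-upTo-≥ term above (s≤s (≤-trans (m≤n*m m 2) 2m≤k)) ⟩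
  sumℤ (map term (upTo (suc m)))                         ≡⟨ sumℤ-upTo-suc term m ⟩
  sumℤ (map term (upTo m)) + γ m * γcoeff k m m          ≡⟨ cong (_+_ (sumℤ (map term (upTo m))))
                                                                 (trans (cong (γ m *_) diagonal) (ℤ.*-identityʳ (γ m))) ⟩
  sumℤ (map term (upTo m)) + γ m                         ∎
  where
  open ≡-Reasoning
  term : ℕ → ℤ
  term = λ i → γ i * γcoeff k i m
  above : ∀ i → suc m ≤ i → term i ≡ + 0
  above i m<i = trans (cong (γ i *_) (if-false (≰⇒≤ᵇ≡false (<⇒≱ m<i)))) (ℤ.*-zeroʳ (γ i))
  diagonal : γcoeff k m m ≡ + 1
  diagonal = trans (if-true (≤⇒≤ᵇ≡true (≤-refl {m}))) (cong (λ j → + ((k ∸ 2 *ℕ m) choose j)) (n∸n≡0 m))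

solve-for-last : ∀ a b x y w → (a + b) + x ≡ (a + y) + w → x ≡ y + (w - b)
solve-for-last a b x y w eq = begin
  x                                ≡⟨ solve 3 (λ a b x → x := ((a :+ b) :+ x) :- a :- b) refl a b x ⟩
  ((a + b) + x) - a - b            ≡⟨ cong (λ z → z - a - b) eq ⟩
  ((a + y) + w) - a - b            ≡⟨ solve 4 (λ a b y w → ((a :+ y) :+ w) :- a :- b := y :+ (w :- b)) refl a b y w ⟩
  y + (w - b)                      ∎
  where
  open ≡-Reasoning
  open +-*-Solver using (solve; _:=_; _:+_; _:-_)

γ-shift : ∀ {k Z Z′ W γ γ′} → Z′ ≗ (Z +P W) → IsGamma k Z γ → IsGamma k Z′ γ′ → γ′ ≗ (γ +P γ-solve k W)
γ-shift {k} {Z} {Z′} {W} {γ} {γ′} Z′≗Z+W isγ isγ′ m = agree-below (suc m) ≤-refl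
  where
  g : Poly
  g = γ-solve k W
  sum< : Poly → ℕ → ℤ
  sum< p m = sumℤ (map (λ i → p i * γcoeff k i m) (upTo m))
  agree-below : ∀ m {i} → i < m → γ′ i ≡ γ i + g i
  agree-at : ∀ m → γ′ m ≡ γ m + g m
  agree-below (suc m) {i} i<1+m with i <? m
  ... | yes i<m = agree-below m i<m
  ... | no i≮m with ≤-antisym (≤-pred i<1+m) (≮⇒≥ i≮m)
  ...   | refl = agree-at m
  agree-at m with k <? 2 *ℕ m
  ... | yes k<2m = trans (proj₁ isγ′ m k<2m) (sym (trans (cong₂ _+_ (proj₁ isγ m k<2m) (if-true (<⇒<ᵇ≡true k<2m))) refl))
  ... | no k≮2m = begin
    γ′ m                               ≡⟨ solve-for-last (sum< γ m) (sum< g m) (γ′ m) (γ m) (W m) balance ⟩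
    γ m + (W m - sum< g m)             ≡⟨ cong (λ s → γ m + (W m - s)) (sumℤ-map-cong (upTo m) (λ {i} i∈ → cong (_* γcoeff k i m) (γ-table-lookup k W m (∈-upTo⁻ i∈)))) ⟨
    γ m + (W m - sum< (γ-table k W m) m) ≡⟨ cong (_+_ (γ m)) (if-false (≮⇒<ᵇ≡false k≮2m)) ⟨
    γ m + g m                          ∎
    where
    open ≡-Reasoning
    2m≤k : 2 *ℕ m ≤ k
    2m≤k = ≮⇒≥ k≮2m
    sum<-γ′ : sum< γ′ m ≡ sum< γ m + sum< g m
    sum<-γ′ = trans (sumℤ-map-cong (upTo m) λ {i} i∈ → trans (cong (_* γcoeff k i m) (agree-below m (∈-upTo⁻ i∈)))
                                                              (ℤ.*-distribʳ-+ (γcoeff k i m) (γ i) (g i)))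
                    (sumℤ-map-+ (λ i → γ i * γcoeff k i m) (λ i → g i * γcoeff k i m) (upTo m))
    balance : (sum< γ m + sum< g m) + γ′ m ≡ (sum< γ m + γ m) + W m
    balance = begin
      (sum< γ m + sum< g m) + γ′ m     ≡⟨ cong (_+ γ′ m) sum<-γ′ ⟨
      sum< γ′ m + γ′ m                 ≡⟨ IsGamma-coeff isγ′ 2m≤k ⟨
      Z′ m                             ≡⟨ Z′≗Z+W m ⟩
      Z m + W m                        ≡⟨ cong (_+ W m) (IsGamma-coeff isγ 2m≤k) ⟩
      (sum< γ m + γ m) + W m           ∎

-- Matroids given by bases

module _ {X : Set} where

  maxᶠ : (X → Bool) → (X → ℕ) → List X → ℕ
  maxᶠ p f L = foldr _⊔_ 0 (map f (filterᵇ p L))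

  maxᶠ-≥ : ∀ {p} f {L x} → x ∈ˡ L → p x ≡ true → f x ≤ maxᶠ p f L
  maxᶠ-≥ {p} f {y ∷ L} (hereˡ refl) px rewrite px = m≤m⊔n (f y) _
  maxᶠ-≥ {p} f {y ∷ L} (thereˡ x∈L) px with p y
  ... | true = ≤-trans (maxᶠ-≥ f x∈L px) (m≤n⊔m (f y) _)
  ... | false = maxᶠ-≥ f x∈L px

  maxᶠ-≤ : ∀ p f L {c} → (∀ {x} → x ∈ˡ L → p x ≡ true → f x ≤ c) → maxᶠ p f L ≤ c
  maxᶠ-≤ p f [] _ = z≤n
  maxᶠ-≤ p f (y ∷ L) bound with p y in py
  ... | true = ⊔-lub (bound (hereˡ refl) py) (maxᶠ-≤ p f L (bound ∘ thereˡ))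
  ... | false = maxᶠ-≤ p f L (bound ∘ thereˡ)

  maxᶠ-attained : ∀ p f L → maxᶠ p f L ≡ 0 ⊎ ∃[ x ] p x ≡ true × maxᶠ p f L ≡ f x
  maxᶠ-attained p f [] = inj₁ refl
  maxᶠ-attained p f (y ∷ L) with p y in py
  ... | false = maxᶠ-attained p f L
  ... | true with maxᶠ-attained p f L
  ...   | inj₁ rest≡0 = inj₂ (y , py , trans (cong (f y ⊔_) rest≡0) (⊔-identityʳ (f y)))
  ...   | inj₂ (x , px , rest≡fx) with ⊔-sel (f y) (maxᶠ p f L)
  ...     | inj₁ ≡fy = inj₂ (y , py , ≡fy)
  ...     | inj₂ ≡rest = inj₂ (x , px , trans ≡rest rest≡fx)

  maxᶠ-∨ : ∀ p q f L → maxᶠ (λ x → p x ∨ q x) f L ≡ maxᶠ p f L ⊔ maxᶠ q f L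
  maxᶠ-∨ p q f L = ≤-antisym (maxᶠ-≤ (λ x → p x ∨ q x) f L bound)
    (⊔-lub (maxᶠ-≤ p f L λ {x} x∈L px → maxᶠ-≥ {p = λ x → p x ∨ q x} f x∈L (cong (_∨ q x) px))
           (maxᶠ-≤ q f L λ {x} x∈L qx → maxᶠ-≥ {p = λ x → p x ∨ q x} f x∈L (trans (cong (p x ∨_) qx) (∨-zeroʳ (p x)))))
    where
    bound : ∀ {x} → x ∈ˡ L → (p x ∨ q x) ≡ true → f x ≤ maxᶠ p f L ⊔ maxᶠ q f L
    bound {x} x∈L p∨q with p x in px
    ... | true = ≤-trans (maxᶠ-≥ {p = p} f x∈L px) (m≤m⊔n _ _)
    ... | false = ≤-trans (maxᶠ-≥ {p = q} f x∈L p∨q) (m≤n⊔m _ _)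

∈-allSubsets : (A : Subset n) → A ∈ˡ allSubsets n
∈-allSubsets [] = hereˡ refl
∈-allSubsets {suc n} (true ∷ A) = ∈-++⁺ˡ (∈-map⁺ (true ∷_) (∈-allSubsets A))
∈-allSubsets {suc n} (false ∷ A) = ∈-++⁺ʳ (map (true ∷_) (allSubsets n)) (∈-map⁺ (false ∷_) (∈-allSubsets A))

module BasisRank (𝓑 : Bases n) where

  rkB-≥ : ∀ A {B} → IsBase 𝓑 B → ∣ A ∩ B ∣ ≤ rkB 𝓑 A
  rkB-≥ A {B} B-base = maxᶠ-≥ {p = 𝓑} (λ B → ∣ A ∩ B ∣) (∈-allSubsets B) B-base

  rkB-≤ : ∀ A {c} → (∀ {B} → IsBase 𝓑 B → ∣ A ∩ B ∣ ≤ c) → rkB 𝓑 A ≤ c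
  rkB-≤ A bound = maxᶠ-≤ 𝓑 (λ B → ∣ A ∩ B ∣) (allSubsets _) (λ _ → bound)

  rkB-attained : (∃[ B₀ ] IsBase 𝓑 B₀) → ∀ A → ∃[ B ] IsBase 𝓑 B × rkB 𝓑 A ≡ ∣ A ∩ B ∣
  rkB-attained (B₀ , B₀-base) A with maxᶠ-attained 𝓑 (λ B → ∣ A ∩ B ∣) (allSubsets _)
  ... | inj₂ attained = attained
  ... | inj₁ rk≡0 = B₀ , B₀-base , trans rk≡0 (sym (n≤0⇒n≡0 (≤-trans (rkB-≥ A B₀-base) (≤-reflexive rk≡0))))

  rkB-≤∣∣ : ∀ A → rkB 𝓑 A ≤ ∣ A ∣
  rkB-≤∣∣ A = rkB-≤ A λ {B} _ → ∣p∩q∣≤∣p∣ A B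

  rkB-mono : ∀ {A A′} → A ⊆ A′ → rkB 𝓑 A ≤ rkB 𝓑 A′
  rkB-mono {A} {A′} A⊆A′ = rkB-≤ A λ B-base → ≤-trans (p⊆q⇒∣p∣≤∣q∣ (∩-⊆-mono A⊆A′)) (rkB-≥ A′ B-base)

  rkB-∪⁅x⁆ : ∀ A x → rkB 𝓑 (A ∪ ⁅ x ⁆) ≤ suc (rkB 𝓑 A)
  rkB-∪⁅x⁆ A x = rkB-≤ (A ∪ ⁅ x ⁆) λ {B} B-base → begin
    ∣ (A ∪ ⁅ x ⁆) ∩ B ∣      ≤⟨ p⊆q⇒∣p∣≤∣q∣ ⊆[A∩B]∪⁅x⁆ ⟩
    ∣ (A ∩ B) ∪ ⁅ x ⁆ ∣      ≤⟨ ∣∪⁅x⁆∣≤ (A ∩ B) x ⟩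
    suc ∣ A ∩ B ∣            ≤⟨ s≤s (rkB-≥ A B-base) ⟩
    suc (rkB 𝓑 A)            ∎
    where
    open ≤-Reasoning
    ⊆[A∩B]∪⁅x⁆ : ∀ {B} → (A ∪ ⁅ x ⁆) ∩ B ⊆ (A ∩ B) ∪ ⁅ x ⁆
    ⊆[A∩B]∪⁅x⁆ {B} y∈ with x∈p∩q⁻ (A ∪ ⁅ x ⁆) B y∈
    ... | y∈A∪x , y∈B with x∈p∪q⁻ A ⁅ x ⁆ y∈A∪x
    ...   | inj₁ y∈A = p⊆p∪q ⁅ x ⁆ (x∈p∩q⁺ (y∈A , y∈B))
    ...   | inj₂ y∈⁅x⁆ = q⊆p∪q (A ∩ B) ⁅ x ⁆ y∈⁅x⁆

  rkB-independent : ∀ {B I} → IsBase 𝓑 B → I ⊆ B → rkB 𝓑 I ≡ ∣ I ∣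
  rkB-independent {I = I} B-base I⊆B =
    ≤-antisym (rkB-≤∣∣ I) (≤-trans (≤-reflexive (cong ∣_∣ (sym (⊆⇒∩≡ I⊆B)))) (rkB-≥ I B-base))

module StressedFromBases (𝓑 : Bases n) (matroid : IsMatroid 𝓑) {k : ℕ} (k-pos : 0 < k)
                         (rank≡k : rkB 𝓑 ⊤ ≡ k) {H : Subset n} (stressed : IsStressedHyperplane 𝓑 H)
                         (H-nonempty : 0 < ∣ H ∣) where
  open BasisRank 𝓑

  private
    h : ℕ
    h = ∣ H ∣
    k∸1<k : k ∸ 1 < k
    k∸1<k = ≤-reflexive (0<⇒suc[∸1] k-pos)

  some-base : ∃[ B ] IsBase 𝓑 B
  some-base = proj₁ matroid

  exchange : ∀ {B₁ B₂ x} → IsBase 𝓑 B₁ → IsBase 𝓑 B₂ → x ∈ B₁ → x ∉ B₂ →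
    ∃[ y ] y ∈ B₂ × y ∉ B₁ × IsBase 𝓑 ((B₁ ─ ⁅ x ⁆) ∪ ⁅ y ⁆)
  exchange {B₁} {B₂} {x} B₁-base B₂-base x∈B₁ x∉B₂
    with proj₂ matroid B₁ B₂ B₁-base B₂-base x x∈B₁ (∉⇒lookup≡false x∉B₂)
  ... | y , y∈B₂ , y∉B₁ , base = y , y∈B₂ , lookup≡false⇒∉ y∉B₁ , base

  rk-H : rkB 𝓑 H ≡ k ∸ 1
  rk-H = trans (proj₁ (proj₂ stressed)) (cong (_∸ 1) rank≡k)

  k≤1+h : k ≤ suc h
  k≤1+h = ≤-trans (≤-reflexive (sym (0<⇒suc[∸1] k-pos))) (s≤s (≤-trans (≤-reflexive (sym rk-H)) (rkB-≤∣∣ H)))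

  base-size : ∀ {B} → IsBase 𝓑 B → ∣ B ∣ ≤ k
  base-size {B} B-base = ≤-trans (≤-reflexive (cong ∣_∣ (sym (∩-identityˡ B)))) (≤-trans (rkB-≥ ⊤ B-base) (≤-reflexive rank≡k))

  independent-in-H : ∀ {B T} → IsBase 𝓑 B → T ⊆ H → T ⊆ B → ∣ T ∣ ≤ k ∸ 1
  independent-in-H B-base T⊆H T⊆B =
    ≤-trans (≤-reflexive (sym (rkB-independent B-base T⊆B))) (≤-trans (rkB-mono T⊆H) (≤-reflexive rk-H))

  too-large-in-H : ∀ {B T} → IsBase 𝓑 B → T ⊆ H → T ⊆ B → k ≤ ∣ T ∣ → ∀ {X : Set} → X
  too-large-in-H B-base T⊆H T⊆B k≤t = contradiction (≤-trans k≤t (independent-in-H B-base T⊆H T⊆B)) (<⇒≱ k∸1<k)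

  -- a proper subset of a k-subset of H (a circuit) is independent; if H has no k-subset, H itself is
  ∃base-⊇ : ∀ {B} → B ⊆ H → ∣ B ∣ ≤ k ∸ 1 → ∃[ B₀ ] IsBase 𝓑 B₀ × B ⊆ B₀
  ∃base-⊇ {B} B⊆H b≤k∸1 with k ≤? h
  ... | yes k≤h with intermediateSubset B⊆H (≤-trans b≤k∸1 (m∸n≤m k 1)) k≤h
  ...   | S , B⊆S , S⊆H , ∣S∣≡k =
    proj₂ (proj₂ (proj₂ stressed) S S⊆H (trans ∣S∣≡k (sym rank≡k))) B B⊆S
      λ B≡S → <⇒≱ k∸1<k (≤-trans (≤-reflexive (trans (sym ∣S∣≡k) (cong ∣_∣ (sym B≡S)))) b≤k∸1)
  ∃base-⊇ {B} B⊆H b≤k∸1 | no k≰h with rkB-attained some-base H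
  ... | B₀ , B₀-base , rk≡ = B₀ , B₀-base , ⊆-trans B⊆H (∣∩∣≡∣∣⇒⊆ (trans (sym rk≡) (trans rk-H k∸1≡h)))
    where
    k∸1≡h : k ∸ 1 ≡ h
    k∸1≡h = cong (_∸ 1) (≤-antisym k≤1+h (≰⇒> k≰h))

  r-⊆H : ∀ {B} → B ⊆ H → rkB 𝓑 B ≡ ∣ B ∣ ⊓ (k ∸ 1)
  r-⊆H {B} B⊆H with ∣ B ∣ ≤? k ∸ 1
  ... | yes b≤k∸1 with ∃base-⊇ B⊆H b≤k∸1
  ...   | B₀ , B₀-base , B⊆B₀ = trans (rkB-independent B₀-base B⊆B₀) (sym (m≤n⇒m⊓n≡m b≤k∸1))
  r-⊆H {B} B⊆H | no b≰k∸1 with subsetOfSize B (<⇒≤ (≰⇒> b≰k∸1))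
  ...   | T , T⊆B , ∣T∣≡ with ∃base-⊇ (⊆-trans T⊆B B⊆H) (≤-reflexive ∣T∣≡)
  ...     | B₀ , B₀-base , T⊆B₀ =
    trans (≤-antisym (≤-trans (rkB-mono B⊆H) (≤-reflexive rk-H))
                     (≤-trans (≤-reflexive (sym (trans (rkB-independent B₀-base T⊆B₀) ∣T∣≡))) (rkB-mono T⊆B)))
          (sym (m≥n⇒m⊓n≡n (<⇒≤ (≰⇒> b≰k∸1))))

  -- H is a flat of rank k − 1, so some base B₀ meets H ∪ {x} in at least k elements;
  -- such a B₀ contains x and no other element outside H.
  module _ {x : Fin n} (x∉H : x ∉ H) where
    private
      witness : ∃[ B ] IsBase 𝓑 B × rkB 𝓑 (H ∪ ⁅ x ⁆) ≡ ∣ (H ∪ ⁅ x ⁆) ∩ B ∣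
      witness = rkB-attained some-base (H ∪ ⁅ x ⁆)
      B₀ : Subset n
      B₀ = proj₁ witness
      B₀-base : IsBase 𝓑 B₀
      B₀-base = proj₁ (proj₂ witness)
      J : Subset n
      J = (H ∪ ⁅ x ⁆) ∩ B₀

      k≤∣J∣ : k ≤ ∣ J ∣
      k≤∣J∣ = begin
        k                          ≡⟨ sym (0<⇒suc[∸1] k-pos) ⟩
        suc (k ∸ 1)                ≡⟨ cong suc (sym rk-H) ⟩
        suc (rkB 𝓑 H)              ≤⟨ IsFlat.closed (isFlat⇒IsFlat {M = toRMat 𝓑} (proj₁ stressed)) ∈⊤ x∉H ⟩
        rkB 𝓑 (H ∪ ⁅ x ⁆)          ≡⟨ proj₂ (proj₂ witness) ⟩
        ∣ J ∣                      ∎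
        where open ≤-Reasoning

      J⊆[H∩B₀]∪⁅x⁆ : J ⊆ (H ∩ B₀) ∪ ⁅ x ⁆
      J⊆[H∩B₀]∪⁅x⁆ {y} y∈J with x∈p∩q⁻ (H ∪ ⁅ x ⁆) B₀ y∈J
      ... | y∈H∪x , y∈B₀ with x∈p∪q⁻ H ⁅ x ⁆ y∈H∪x
      ...   | inj₁ y∈H = p⊆p∪q ⁅ x ⁆ (x∈p∩q⁺ (y∈H , y∈B₀))
      ...   | inj₂ y∈⁅x⁆ = q⊆p∪q (H ∩ B₀) ⁅ x ⁆ y∈⁅x⁆

      x∈B₀ : x ∈ B₀
      x∈B₀ with x ∈? B₀
      ... | yes x∈B₀ = x∈B₀
      ... | no x∉B₀ = too-large-in-H B₀-base (p∩q⊆p H B₀) (p∩q⊆q H B₀) (≤-trans k≤∣J∣ (p⊆q⇒∣p∣≤∣q∣ J⊆H∩B₀))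
        where
        J⊆H∩B₀ : J ⊆ H ∩ B₀
        J⊆H∩B₀ y∈J with x∈p∪q⁻ (H ∩ B₀) ⁅ x ⁆ (J⊆[H∩B₀]∪⁅x⁆ y∈J)
        ... | inj₁ y∈H∩B₀ = y∈H∩B₀
        ... | inj₂ y∈⁅x⁆ = contradiction (subst (_∈ B₀) (x∈⁅y⁆⇒x≡y x y∈⁅x⁆) (p∩q⊆q (H ∪ ⁅ x ⁆) B₀ y∈J)) x∉B₀

      only-x : ∀ {y} → y ∈ B₀ → y ∉ H → y ≡ x
      only-x {y} y∈B₀ y∉H with y ≟ᶠ x
      ... | yes y≡x = y≡x
      ... | no y≢x = contradiction (base-size B₀-base) (<⇒≱ (begin-strict
        k                 ≤⟨ k≤∣J∣ ⟩
        ∣ J ∣             <⟨ ≤-reflexive (sym (∣∪⁅x⁆∣≡ y∉J)) ⟩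
        ∣ J ∪ ⁅ y ⁆ ∣     ≤⟨ p⊆q⇒∣p∣≤∣q∣ (∪⁅x⁆-⊆ (p∩q⊆q (H ∪ ⁅ x ⁆) B₀) y∈B₀) ⟩
        ∣ B₀ ∣            ∎))
        where
        open ≤-Reasoning
        y∉J : y ∉ J
        y∉J y∈J with x∈p∪q⁻ H ⁅ x ⁆ (p∩q⊆p (H ∪ ⁅ x ⁆) B₀ y∈J)
        ... | inj₁ y∈H = y∉H y∈H
        ... | inj₂ y∈⁅x⁆ = y≢x (x∈⁅y⁆⇒x≡y x y∈⁅x⁆)

      not-all-in-H : ∀ {B₁} → IsBase 𝓑 B₁ → x ∉ B₁ → B₁ ⊈ H
      not-all-in-H B₁-base x∉B₁ B₁⊆H with exchange B₀-base B₁-base x∈B₀ x∉B₁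
      ... | z , z∈B₁ , z∉B₀ , B₂-base =
        too-large-in-H B₂-base (∪⁅x⁆-⊆ (p∩q⊆p H B₀) (B₁⊆H z∈B₁))
          (∪-⊆ (⊆-exchange (p∩q⊆q H B₀) (λ x∈H∩B₀ → x∉H (p∩q⊆p H B₀ x∈H∩B₀))) (⁅x⁆⊆ ∈-exchange))
          (≤-trans (≤-trans k≤∣J∣ (p⊆q⇒∣p∣≤∣q∣ J⊆[H∩B₀]∪⁅x⁆) ) (≤-reflexive (trans (∣∪⁅x⁆∣≡ x∉H∩B₀) (sym (∣∪⁅x⁆∣≡ z∉H∩B₀)))))
        where
        x∉H∩B₀ : x ∉ H ∩ B₀
        x∉H∩B₀ = x∉H ∘ p∩q⊆p H B₀
        z∉H∩B₀ : z ∉ H ∩ B₀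
        z∉H∩B₀ = z∉B₀ ∘ p∩q⊆q H B₀

    ∃base-⊇-∪⁅x⁆ : ∀ {S} → S ⊆ H → ∣ S ∣ ≡ k ∸ 1 → ∃[ B ] IsBase 𝓑 B × S ⊆ B × x ∈ B
    ∃base-⊇-∪⁅x⁆ {S} S⊆H ∣S∣≡ with ∃base-⊇ S⊆H (≤-reflexive ∣S∣≡)
    ... | B₁ , B₁-base , S⊆B₁ with x ∈? B₁
    ...   | yes x∈B₁ = B₁ , B₁-base , S⊆B₁ , x∈B₁
    ...   | no x∉B₁ with ⊈⇒∃ (not-all-in-H B₁-base x∉B₁)
    ...     | y , y∈B₁ , y∉H with exchange B₁-base B₀-base y∈B₁ (λ y∈B₀ → x∉B₁ (subst (_∈ B₁) (only-x y∈B₀ y∉H) y∈B₁))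
    ...       | z , z∈B₀ , z∉B₁ , B₂-base with z ∈? H
    ...         | no z∉H = _ , B₂-base , S⊆B₂ , subst (_∈ _) (only-x z∈B₀ z∉H) ∈-exchange
      where
      S⊆B₂ : S ⊆ (B₁ ─ ⁅ y ⁆) ∪ ⁅ z ⁆
      S⊆B₂ = ⊆-exchange S⊆B₁ (y∉H ∘ S⊆H)
    ...         | yes z∈H = too-large-in-H B₂-base (∪⁅x⁆-⊆ S⊆H z∈H) (∪⁅x⁆-⊆ S⊆B₂ ∈-exchange)
                              (≤-reflexive (sym (trans (∣∪⁅x⁆∣≡ (z∉B₁ ∘ S⊆B₁)) (trans (cong suc ∣S∣≡) (0<⇒suc[∸1] k-pos)))))
      where
      S⊆B₂ : S ⊆ (B₁ ─ ⁅ y ⁆) ∪ ⁅ z ⁆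
      S⊆B₂ = ⊆-exchange S⊆B₁ (y∉H ∘ S⊆H)

  r-⊆H∪⁅x⁆ : ∀ {B x} → B ⊆ H → x ∉ H → rkB 𝓑 (B ∪ ⁅ x ⁆) ≡ suc (∣ B ∣ ⊓ (k ∸ 1))
  r-⊆H∪⁅x⁆ {B} {x} B⊆H x∉H with subsetOfSize B (m⊓n≤m ∣ B ∣ (k ∸ 1))
  ... | T , T⊆B , ∣T∣≡ with intermediateSubset (⊆-trans T⊆B B⊆H) (≤-trans (≤-reflexive ∣T∣≡) (m⊓n≤n _ _))
                                               (≤-pred (≤-trans (≤-reflexive (0<⇒suc[∸1] k-pos)) k≤1+h))
  ...   | S , T⊆S , S⊆H , ∣S∣≡ with ∃base-⊇-∪⁅x⁆ x∉H S⊆H ∣S∣≡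
  ...     | B₀ , B₀-base , S⊆B₀ , x∈B₀ = ≤-antisym upper lower
    where
    open ≤-Reasoning
    upper : rkB 𝓑 (B ∪ ⁅ x ⁆) ≤ suc (∣ B ∣ ⊓ (k ∸ 1))
    upper = ≤-trans (rkB-∪⁅x⁆ B x) (s≤s (≤-reflexive (r-⊆H B⊆H)))
    lower : suc (∣ B ∣ ⊓ (k ∸ 1)) ≤ rkB 𝓑 (B ∪ ⁅ x ⁆)
    lower = begin
      suc (∣ B ∣ ⊓ (k ∸ 1))   ≡⟨ cong suc (sym ∣T∣≡) ⟩
      suc ∣ T ∣               ≡⟨ sym (∣∪⁅x⁆∣≡ (x∉H ∘ B⊆H ∘ T⊆B)) ⟩
      ∣ T ∪ ⁅ x ⁆ ∣           ≡⟨ sym (rkB-independent B₀-base (∪⁅x⁆-⊆ (⊆-trans T⊆S S⊆B₀) x∈B₀)) ⟩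
      rkB 𝓑 (T ∪ ⁅ x ⁆)       ≤⟨ rkB-mono (∪⁅x⁆-⊆ (⊆-trans T⊆B (p⊆p∪q ⁅ x ⁆)) (q⊆p∪q B ⁅ x ⁆ (x∈⁅x⁆ x))) ⟩
      rkB 𝓑 (B ∪ ⁅ x ⁆)       ∎

  stressedHyperplane : StressedHyperplane (toRMat 𝓑) k H
  stressedHyperplane = record
    { k-pos = k-pos
    ; H-nonempty = H-nonempty
    ; k≤1+∣H∣ = k≤1+h
    ; H⊆E = ⊆⊤
    ; rank≡k = rank≡k
    ; r-⊆H = r-⊆H
    ; r-⊆H∪⁅x⁆ = λ B⊆H _ x∉H → r-⊆H∪⁅x⁆ B⊆H x∉H
    ; r-mono = λ A⊆B _ → rkB-mono A⊆B
    }

  private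
    relaxed : Subset n → Bool
    relaxed S = subᵇ S H ∧ (∣ S ∣ ≡ᵇ rkB 𝓑 ⊤)

    maxRelaxed : Subset n → ℕ
    maxRelaxed A = maxᶠ relaxed (λ S → ∣ A ∩ S ∣) (allSubsets n)

    relaxed⇒ : ∀ {S} → relaxed S ≡ true → S ⊆ H × ∣ S ∣ ≡ k
    relaxed⇒ {S} eq = subᵇ⇒⊆ (∧-conicalˡ (subᵇ S H) _ eq) , trans (≡ᵇ≡true⇒≡ (∧-conicalʳ (subᵇ S H) _ eq)) rank≡k

    rk′≡ : ∀ A → rkB (relax 𝓑 H) A ≡ rkB 𝓑 A ⊔ maxRelaxed A
    rk′≡ A = maxᶠ-∨ 𝓑 relaxed (λ S → ∣ A ∩ S ∣) (allSubsets n)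

    maxRelaxed-≤k : ∀ A → maxRelaxed A ≤ k
    maxRelaxed-≤k A = maxᶠ-≤ relaxed _ (allSubsets n) λ {S} _ eq →
      ≤-trans (∣p∩q∣≤∣q∣ A S) (≤-reflexive (proj₂ (relaxed⇒ {S} eq)))

    maxRelaxed-large : ∀ {A} → A ⊆ H → k ≤ ∣ A ∣ → k ≤ maxRelaxed A
    maxRelaxed-large {A} A⊆H k≤a with subsetOfSize A k≤a
    ... | S , S⊆A , ∣S∣≡k = begin
      k              ≡⟨ sym ∣S∣≡k ⟩
      ∣ S ∣          ≤⟨ p⊆q⇒∣p∣≤∣q∣ (λ x∈S → x∈p∩q⁺ (S⊆A x∈S , x∈S)) ⟩
      ∣ A ∩ S ∣      ≤⟨ maxᶠ-≥ {p = relaxed} (λ S → ∣ A ∩ S ∣) (∈-allSubsets S)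
                          (cong₂ _∧_ (⊆⇒subᵇ (⊆-trans S⊆A A⊆H)) (≡⇒≡ᵇ≡true (trans ∣S∣≡k (sym rank≡k)))) ⟩
      maxRelaxed A   ∎
      where open ≤-Reasoning

    maxRelaxed-≤rk : ∀ {A} → ¬ (A ⊆ H × k ≤ ∣ A ∣) → maxRelaxed A ≤ rkB 𝓑 A
    maxRelaxed-≤rk {A} not-large = maxᶠ-≤ relaxed _ (allSubsets n) λ {S} _ eq → bound (relaxed⇒ {S} eq)
      where
      T : Subset n
      T = A ∩ H
      bound : ∀ {S} → S ⊆ H × ∣ S ∣ ≡ k → ∣ A ∩ S ∣ ≤ rkB 𝓑 A
      bound {S} (S⊆H , ∣S∣≡k) with ∣ T ∣ ≤? k ∸ 1
      ... | yes t≤k∸1 = begin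
        ∣ A ∩ S ∣          ≤⟨ p⊆q⇒∣p∣≤∣q∣ (∩-⊆-mono′) ⟩
        ∣ T ∣              ≡⟨ sym (trans (r-⊆H (p∩q⊆q A H)) (m≤n⇒m⊓n≡m t≤k∸1)) ⟩
        rkB 𝓑 T            ≤⟨ rkB-mono (p∩q⊆p A H) ⟩
        rkB 𝓑 A            ∎
        where
        open ≤-Reasoning
        ∩-⊆-mono′ : A ∩ S ⊆ T
        ∩-⊆-mono′ x∈A∩S with x∈p∩q⁻ A S x∈A∩S
        ... | x∈A , x∈S = x∈p∩q⁺ (x∈A , S⊆H x∈S)
      ... | no t≰k∸1 with ⊈⇒∃ A⊈H
        where
        k≤t : k ≤ ∣ T ∣
        k≤t = ≤-trans (≤-reflexive (sym (0<⇒suc[∸1] k-pos))) (≰⇒> t≰k∸1)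
        A⊈H : A ⊈ H
        A⊈H A⊆H = not-large (A⊆H , ≤-trans k≤t (∣p∩q∣≤∣p∣ A H))
      ...   | x , x∈A , x∉H = begin
        ∣ A ∩ S ∣                  ≤⟨ ∣p∩q∣≤∣q∣ A S ⟩
        ∣ S ∣                      ≡⟨ ∣S∣≡k ⟩
        k                          ≡⟨ sym (0<⇒suc[∸1] k-pos) ⟩
        suc (k ∸ 1)                ≡⟨ cong suc (sym (m≥n⇒m⊓n≡n (<⇒≤ (≰⇒> t≰k∸1)))) ⟩
        suc (∣ T ∣ ⊓ (k ∸ 1))      ≡⟨ sym (r-⊆H∪⁅x⁆ (p∩q⊆q A H) x∉H) ⟩
        rkB 𝓑 (T ∪ ⁅ x ⁆)          ≤⟨ rkB-mono (∪⁅x⁆-⊆ (p∩q⊆p A H) x∈A) ⟩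
        rkB 𝓑 A                    ∎
        where open ≤-Reasoning

  relaxation : Relaxation (toRMat 𝓑) k H (toRMat (relax 𝓑 H))
  relaxation = record
    { E′≡E = refl
    ; r′-large = λ {A} A⊆H k≤a → trans (rk′≡ A)
        (trans (cong₂ _⊔_ (trans (r-⊆H A⊆H) (≤1+⇒⊓[∸1]≡ (m≤n⇒m≤1+n k≤a)))
                          (≤-antisym (maxRelaxed-≤k A) (maxRelaxed-large A⊆H k≤a)))
               (m≤n⇒m⊔n≡n (m∸n≤m k 1)))
    ; r′-⊈H = λ {A} _ A⊈H → trans (rk′≡ A) (m≥n⇒m⊔n≡m (maxRelaxed-≤rk {A} (A⊈H ∘ proj₁)))
    ; r′-small = λ {A} _ a<k → trans (rk′≡ A) (m≥n⇒m⊔n≡m (maxRelaxed-≤rk {A} λ (_ , k≤a) → <⇒≱ a<k k≤a))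
    }

theorem5p8 : (k h : ℕ) → 1 ≤ k → 1 ≤ h →
    Σ Poly λ g → IsPoly g ×
      ((n : ℕ) (𝓑 : Bases n) → IsMatroid 𝓑 → rank (toRMat 𝓑) ≡ k →
       (H : Subset n) → IsStressedHyperplane 𝓑 H → ∣ H ∣ ≡ h →
       (γM γR : Poly) →
       IsGamma (rank (toRMat 𝓑)) (Zpoly (toRMat 𝓑)) γM →
       IsGamma (rank (toRMat (relax 𝓑 H))) (Zpoly (toRMat (relax 𝓑 H))) γR →
       (i : ℕ) → γR i ≡ γM i + g i)
theorem5p8 k h k-pos h-pos =
  γ-solve k (Z-defect k h) , IsPoly-γ-solve k (Z-defect k h) , relaxation-shifts-γ
  where
  relaxation-shifts-γ : (n : ℕ) (𝓑 : Bases n) → IsMatroid 𝓑 → rank (toRMat 𝓑) ≡ k →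
    (H : Subset n) → IsStressedHyperplane 𝓑 H → ∣ H ∣ ≡ h → (γM γR : Poly) →
    IsGamma (rank (toRMat 𝓑)) (Zpoly (toRMat 𝓑)) γM →
    IsGamma (rank (toRMat (relax 𝓑 H))) (Zpoly (toRMat (relax 𝓑 H))) γR →
    γR ≗ (γM +P γ-solve k (Z-defect k h))
  relaxation-shifts-γ n 𝓑 matroid rank≡k H stressed ∣H∣≡h γM γR γM-ok γR-ok =
    γ-shift {W = Z-defect k h} Z-shift (subst (λ c → IsGamma c (Zpoly (toRMat 𝓑)) γM) rank≡k γM-ok)
                                       (subst (λ c → IsGamma c (Zpoly (toRMat (relax 𝓑 H))) γR) rank′≡k γR-ok)
    where
    open StressedFromBases 𝓑 matroid k-pos rank≡k stressed (subst (0 <_) (sym ∣H∣≡h) h-pos)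
    open RelaxationProperties stressedHyperplane relaxation using (rank′≡k)
    Z-shift : Zpoly (toRMat (relax 𝓑 H)) ≗ (Zpoly (toRMat 𝓑) +P Z-defect k h)
    Z-shift m = trans (RelaxedZ.Zpoly-relax stressedHyperplane relaxation m)
                      (cong (λ c → Zpoly (toRMat 𝓑) m + Z-defect k c m) ∣H∣≡h)
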